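{- Let $n \in \mathbb N$, $k \in \{1,\dots,n\}$, let $H$ be a symmetric $n\times n$ matrix all of whose entries are $\pm1$, and write $\det(xI-H)=\sum_{i=0}^n a_ix^{n-i}$. If $n+k$ is odd then $a_{k} \in 2^k \mathbb Z$. -}

module Defs where

open import Data.Nat using (ℕ; zero; suc)
open import Data.Integer using (ℤ; 0ℤ; 1ℤ; -_) renaming (_+_ to _+ℤ_; _*_ to _*ℤ_)
open import Data.Fin using (Fin; zero; suc; punchIn; _≟_)
open import Data.List using (List; []; _∷_; tabulate)
open import Relation.Nullary using (yes; no)

-- Polynomials over ℤ as lists of coefficients in ASCENDING degree order:
-- [c₀, c₁, …] represents c₀ + c₁ x + c₂ x² + …
Poly : Set
Poly = List ℤ

0ₚ : Poly
0ₚ = []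

1ₚ : Poly
1ₚ = 1ℤ ∷ []

_+ₚ_ : Poly → Poly → Poly
[]      +ₚ q       = q
(a ∷ p) +ₚ []      = a ∷ p
(a ∷ p) +ₚ (b ∷ q) = (a +ℤ b) ∷ (p +ₚ q)

scaleₚ : ℤ → Poly → Poly
scaleₚ c []      = []
scaleₚ c (a ∷ p) = (c *ℤ a) ∷ scaleₚ c p

-ₚ_ : Poly → Poly
-ₚ p = scaleₚ (- 1ℤ) p

_*ₚ_ : Poly → Poly → Poly
[]      *ₚ q = []
(a ∷ p) *ₚ q = scaleₚ a q +ₚ (0ℤ ∷ (p *ₚ q))

coeff : Poly → ℕ → ℤ
coeff []      i       = 0ℤ
coeff (a ∷ p) zero    = a
coeff (a ∷ p) (suc i) = coeff p i

Matrix : Set → ℕ → Set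
Matrix A n = Fin n → Fin n → A

module Det {A : Set} (0# 1# : A) (_+_ _*_ : A → A → A) (-_ : A → A) where

  altSum : List A → A
  altSum []       = 0#
  altSum (x ∷ xs) = x + (- altSum xs)

  minor : ∀ {n} → Fin (suc n) → Matrix A (suc n) → Matrix A n
  minor j M i l = M (suc i) (punchIn j l)

  det : ∀ n → Matrix A n → A
  det zero    M = 1#
  det (suc n) M = altSum (tabulate (λ j → M zero j * det n (minor j M)))

detₚ : ∀ n → Matrix Poly n → Poly
detₚ = Det.det 0ₚ 1ₚ _+ₚ_ _*ₚ_ -ₚ_

xI-H : ∀ {n} → Matrix ℤ n → Matrix Poly n
xI-H H i j with i ≟ j
... | yes _ = (- H i j) ∷ 1ℤ ∷ []
... | no  _ = (- H i j) ∷ []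

charPoly : ∀ n → Matrix ℤ n → Poly
charPoly n H = detₚ n (xI-H H)

-- a_i where det(xI - H) = Σ_{i=0}^n a_i x^{n-i}, i.e. coefficient of x^{n-i}
charCoeff : ∀ n → Matrix ℤ n → ℕ → ℤ
charCoeff n H i = coeff (charPoly n H) (n Data.Nat.∸ i)

-- With J the all-ones matrix, put A = xI − H + J.  Each entry of A is x δᵢⱼ + eᵢⱼ with
-- eᵢⱼ = 1 − Hᵢⱼ ∈ {0, 2}, so 2^(n−j) divides the coefficient of xʲ in det A, and 2^(n−1−j)
-- the one in every cofactor Cᵢⱼ of A.  Since J = 𝟙𝟙ᵀ has rank one,
--   det (xI − H) = det (A − J) = det A − Σᵢⱼ Cᵢⱼ = det A − (det A)′ − 2 Σ_{i<j} Cᵢⱼ,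
-- by Jacobi's formula Σᵢ Cᵢᵢ = (det A)′ and the symmetry of the adjugate of the symmetric
-- matrix A (cancel det A, which is monic, from adj A · A = det A · I).  At x^(n−k) the first
-- and last terms are divisible by 2^k; the middle one is (n − k + 1) times a coefficient
-- divisible by 2^(k−1), and n − k + 1 is even.

module Submission where

open import Defs
open import Level as Universe using (0ℓ)
open import Algebra.Bundles using (CommutativeRing)
open import Data.Nat as ℕ using (ℕ; zero; suc)
open import Data.Fin using (Fin; zero; suc; punchIn; punchOut)
open import Data.List using ([]; _∷_)
open import Relation.Nullary using (contradiction)
open import Relation.Binary.PropositionalEquality as ≡ using (_≡_; _≢_)

module Polynomial where

  open import Data.Integer using (ℤ; +_; 0ℤ; 1ℤ; -_) renaming (_+_ to _+ℤ_; _*_ to _*ℤ_)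
  import Data.Integer.Properties as ℤ
  open import Data.Nat using (_≤_; _<_; z≤n; s≤s)
  import Data.Nat.Properties as ℕ
  open import Data.List using (length)
  open import Data.Sum using (inj₁; inj₂)
  open import Data.Integer.Tactic.RingSolver using (solve-∀)
  open import Relation.Binary.Bundles using (Setoid)
  open import Relation.Binary.Structures using (IsEquivalence)
  import Relation.Binary.Reasoning.Setoid
  open import Algebra.Bundles using (AbelianGroup)
  open import Algebra.Structures using (IsAbelianGroup)
  import Algebra.Properties.CommutativeSemigroup as CommSemigroupProperties
  open import Data.Product using (_,_)
  open ≡ using (refl; sym; trans; cong; cong₂)

  infix 4 _≈ₚ_
  record _≈ₚ_ (p q : Poly) : Set where
    constructor mk≈
    field at : ∀ i → coeff p i ≡ coeff q i
  open _≈ₚ_ public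

  ≈ₚ-isEquivalence : IsEquivalence _≈ₚ_
  ≈ₚ-isEquivalence = record
    { refl  = mk≈ λ i → refl
    ; sym   = λ e → mk≈ λ i → sym (at e i)
    ; trans = λ e f → mk≈ λ i → trans (at e i) (at f i)
    }

  open IsEquivalence ≈ₚ-isEquivalence public
    renaming (refl to ≈ₚ-refl; sym to ≈ₚ-sym; trans to ≈ₚ-trans)

  ≈ₚ-setoid : Setoid 0ℓ 0ℓ
  ≈ₚ-setoid = record { isEquivalence = ≈ₚ-isEquivalence }

  coeff-+ₚ : ∀ p q i → coeff (p +ₚ q) i ≡ coeff p i +ℤ coeff q i
  coeff-+ₚ []      q       i       = sym (ℤ.+-identityˡ _)
  coeff-+ₚ (a ∷ p) []      i       = sym (ℤ.+-identityʳ _)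
  coeff-+ₚ (a ∷ p) (b ∷ q) zero    = refl
  coeff-+ₚ (a ∷ p) (b ∷ q) (suc i) = coeff-+ₚ p q i

  coeff-scaleₚ : ∀ a p i → coeff (scaleₚ a p) i ≡ a *ℤ coeff p i
  coeff-scaleₚ a []      i       = sym (ℤ.*-zeroʳ a)
  coeff-scaleₚ a (b ∷ p) zero    = refl
  coeff-scaleₚ a (b ∷ p) (suc i) = coeff-scaleₚ a p i

  coeff--ₚ : ∀ p i → coeff (-ₚ p) i ≡ - coeff p i
  coeff--ₚ p i = trans (coeff-scaleₚ (- 1ℤ) p i) (ℤ.-1*i≡-i (coeff p i))

  ∷-cong : ∀ {a b p q} → a ≡ b → p ≈ₚ q → (a ∷ p) ≈ₚ (b ∷ q)
  ∷-cong e f = mk≈ λ { zero → e ; (suc i) → at f i }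

  +ₚ-cong : ∀ {p p′ q q′} → p ≈ₚ p′ → q ≈ₚ q′ → p +ₚ q ≈ₚ p′ +ₚ q′
  +ₚ-cong {p} {p′} {q} {q′} e f = mk≈ λ i →
    trans (coeff-+ₚ p q i) (trans (cong₂ _+ℤ_ (at e i) (at f i)) (sym (coeff-+ₚ p′ q′ i)))

  +ₚ-congˡ : ∀ p {q q′} → q ≈ₚ q′ → p +ₚ q ≈ₚ p +ₚ q′
  +ₚ-congˡ p = +ₚ-cong (≈ₚ-refl {p})

  +ₚ-congʳ : ∀ q {p p′} → p ≈ₚ p′ → p +ₚ q ≈ₚ p′ +ₚ q
  +ₚ-congʳ q e = +ₚ-cong e (≈ₚ-refl {q})

  scaleₚ-cong : ∀ a {p q} → p ≈ₚ q → scaleₚ a p ≈ₚ scaleₚ a q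
  scaleₚ-cong a {p} {q} e = mk≈ λ i →
    trans (coeff-scaleₚ a p i) (trans (cong (a *ℤ_) (at e i)) (sym (coeff-scaleₚ a q i)))

  +ₚ-assoc : ∀ p q r → (p +ₚ q) +ₚ r ≈ₚ p +ₚ (q +ₚ r)
  +ₚ-assoc p q r = mk≈ λ i → begin
    coeff ((p +ₚ q) +ₚ r) i                ≡⟨ coeff-+ₚ (p +ₚ q) r i ⟩
    coeff (p +ₚ q) i +ℤ coeff r i          ≡⟨ cong (_+ℤ coeff r i) (coeff-+ₚ p q i) ⟩
    coeff p i +ℤ coeff q i +ℤ coeff r i    ≡⟨ ℤ.+-assoc (coeff p i) (coeff q i) (coeff r i) ⟩
    coeff p i +ℤ (coeff q i +ℤ coeff r i)  ≡⟨ cong (coeff p i +ℤ_) (coeff-+ₚ q r i) ⟨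
    coeff p i +ℤ coeff (q +ₚ r) i          ≡⟨ coeff-+ₚ p (q +ₚ r) i ⟨
    coeff (p +ₚ (q +ₚ r)) i                ∎
    where open ≡.≡-Reasoning

  +ₚ-comm : ∀ p q → p +ₚ q ≈ₚ q +ₚ p
  +ₚ-comm p q = mk≈ λ i →
    trans (coeff-+ₚ p q i) (trans (ℤ.+-comm (coeff p i) (coeff q i)) (sym (coeff-+ₚ q p i)))

  +ₚ-identityʳ : ∀ p → p +ₚ 0ₚ ≈ₚ p
  +ₚ-identityʳ p = mk≈ λ i → trans (coeff-+ₚ p [] i) (ℤ.+-identityʳ _)

  +ₚ-inverseˡ : ∀ p → (-ₚ p) +ₚ p ≈ₚ 0ₚ
  +ₚ-inverseˡ p = mk≈ λ i →
    trans (coeff-+ₚ (-ₚ p) p i) (trans (cong (_+ℤ coeff p i) (coeff--ₚ p i)) (ℤ.+-inverseˡ (coeff p i)))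

  +ₚ-inverseʳ : ∀ p → p +ₚ (-ₚ p) ≈ₚ 0ₚ
  +ₚ-inverseʳ p = ≈ₚ-trans (+ₚ-comm p (-ₚ p)) (+ₚ-inverseˡ p)

  scaleₚ-+ₚ : ∀ a p q → scaleₚ a (p +ₚ q) ≈ₚ scaleₚ a p +ₚ scaleₚ a q
  scaleₚ-+ₚ a p q = mk≈ λ i → begin
    coeff (scaleₚ a (p +ₚ q)) i                   ≡⟨ coeff-scaleₚ a (p +ₚ q) i ⟩
    a *ℤ coeff (p +ₚ q) i                         ≡⟨ cong (a *ℤ_) (coeff-+ₚ p q i) ⟩
    a *ℤ (coeff p i +ℤ coeff q i)                 ≡⟨ ℤ.*-distribˡ-+ a (coeff p i) (coeff q i) ⟩
    a *ℤ coeff p i +ℤ a *ℤ coeff q i              ≡⟨ cong₂ _+ℤ_ (coeff-scaleₚ a p i) (coeff-scaleₚ a q i) ⟨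
    coeff (scaleₚ a p) i +ℤ coeff (scaleₚ a q) i  ≡⟨ coeff-+ₚ (scaleₚ a p) (scaleₚ a q) i ⟨
    coeff (scaleₚ a p +ₚ scaleₚ a q) i            ∎
    where open ≡.≡-Reasoning

  +-scaleₚ : ∀ a b p → scaleₚ (a +ℤ b) p ≈ₚ scaleₚ a p +ₚ scaleₚ b p
  +-scaleₚ a b p = mk≈ λ i → begin
    coeff (scaleₚ (a +ℤ b) p) i                   ≡⟨ coeff-scaleₚ (a +ℤ b) p i ⟩
    (a +ℤ b) *ℤ coeff p i                         ≡⟨ ℤ.*-distribʳ-+ (coeff p i) a b ⟩
    a *ℤ coeff p i +ℤ b *ℤ coeff p i              ≡⟨ cong₂ _+ℤ_ (coeff-scaleₚ a p i) (coeff-scaleₚ b p i) ⟨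
    coeff (scaleₚ a p) i +ℤ coeff (scaleₚ b p) i  ≡⟨ coeff-+ₚ (scaleₚ a p) (scaleₚ b p) i ⟨
    coeff (scaleₚ a p +ₚ scaleₚ b p) i            ∎
    where open ≡.≡-Reasoning

  scaleₚ-scaleₚ : ∀ a b p → scaleₚ a (scaleₚ b p) ≈ₚ scaleₚ (a *ℤ b) p
  scaleₚ-scaleₚ a b p = mk≈ λ i → begin
    coeff (scaleₚ a (scaleₚ b p)) i   ≡⟨ coeff-scaleₚ a (scaleₚ b p) i ⟩
    a *ℤ coeff (scaleₚ b p) i         ≡⟨ cong (a *ℤ_) (coeff-scaleₚ b p i) ⟩
    a *ℤ (b *ℤ coeff p i)             ≡⟨ ℤ.*-assoc a b (coeff p i) ⟨
    a *ℤ b *ℤ coeff p i               ≡⟨ coeff-scaleₚ (a *ℤ b) p i ⟨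
    coeff (scaleₚ (a *ℤ b) p) i       ∎
    where open ≡.≡-Reasoning

  scaleₚ-0 : ∀ p → scaleₚ 0ℤ p ≈ₚ 0ₚ
  scaleₚ-0 p = mk≈ λ i → trans (coeff-scaleₚ 0ℤ p i) (ℤ.*-zeroˡ (coeff p i))


  scaleₚ-1 : ∀ p → scaleₚ 1ℤ p ≈ₚ p
  scaleₚ-1 p = mk≈ λ i → trans (coeff-scaleₚ 1ℤ p i) (ℤ.*-identityˡ (coeff p i))

  +ₚ-isAbelianGroup : IsAbelianGroup _≈ₚ_ _+ₚ_ 0ₚ -ₚ_
  +ₚ-isAbelianGroup = record
    { isGroup = record
      { isMonoid = record
        { isSemigroup = record
          { isMagma = record { isEquivalence = ≈ₚ-isEquivalence ; ∙-cong = +ₚ-cong }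
          ; assoc   = +ₚ-assoc
          }
        ; identity = (λ p → ≈ₚ-refl) , +ₚ-identityʳ
        }
      ; inverse = +ₚ-inverseˡ , +ₚ-inverseʳ
      ; ⁻¹-cong = scaleₚ-cong (- 1ℤ)
      }
    ; comm = +ₚ-comm
    }

  +ₚ-abelianGroup : AbelianGroup 0ℓ 0ℓ
  +ₚ-abelianGroup = record { isAbelianGroup = +ₚ-isAbelianGroup }

  open CommSemigroupProperties (AbelianGroup.commutativeSemigroup +ₚ-abelianGroup)
    using (interchange; x∙yz≈y∙xz)
  open import Algebra.Properties.AbelianGroup +ₚ-abelianGroup using (x∙y⁻¹≈ε⇒x≈y; x≈y⇒x∙y⁻¹≈ε)

  0∷-≈0 : ∀ {p} → p ≈ₚ 0ₚ → 0ℤ ∷ p ≈ₚ 0ₚ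
  0∷-≈0 e = mk≈ λ { zero → refl ; (suc i) → at e i }

  *ₚ-congʳ : ∀ p {q q′} → q ≈ₚ q′ → p *ₚ q ≈ₚ p *ₚ q′
  *ₚ-congʳ []      e = ≈ₚ-refl
  *ₚ-congʳ (a ∷ p) e = +ₚ-cong (scaleₚ-cong a e) (∷-cong refl (*ₚ-congʳ p e))

  *ₚ-zeroʳ : ∀ p → p *ₚ 0ₚ ≈ₚ 0ₚ
  *ₚ-zeroʳ []      = ≈ₚ-refl
  *ₚ-zeroʳ (a ∷ p) = 0∷-≈0 (*ₚ-zeroʳ p)

  *ₚ-∷ʳ : ∀ p b q → p *ₚ (b ∷ q) ≈ₚ scaleₚ b p +ₚ (0ℤ ∷ (p *ₚ q))
  *ₚ-∷ʳ []      b q = ≈ₚ-sym (0∷-≈0 ≈ₚ-refl)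
  *ₚ-∷ʳ (a ∷ p) b q = ∷-cong (cong (_+ℤ 0ℤ) (ℤ.*-comm a b))
    (≈ₚ-trans (+ₚ-congˡ (scaleₚ a q) (*ₚ-∷ʳ p b q))
              (x∙yz≈y∙xz (scaleₚ a q) (scaleₚ b p) (0ℤ ∷ (p *ₚ q))))

  *ₚ-comm : ∀ p q → p *ₚ q ≈ₚ q *ₚ p
  *ₚ-comm []      q = ≈ₚ-sym (*ₚ-zeroʳ q)
  *ₚ-comm (a ∷ p) q =
    ≈ₚ-trans (+ₚ-congˡ (scaleₚ a q) (∷-cong refl (*ₚ-comm p q))) (≈ₚ-sym (*ₚ-∷ʳ q a p))

  *ₚ-congˡ : ∀ {p p′} q → p ≈ₚ p′ → p *ₚ q ≈ₚ p′ *ₚ q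
  *ₚ-congˡ {p} {p′} q e = ≈ₚ-trans (*ₚ-comm p q) (≈ₚ-trans (*ₚ-congʳ q e) (*ₚ-comm q p′))

  *ₚ-cong : ∀ {p p′ q q′} → p ≈ₚ p′ → q ≈ₚ q′ → p *ₚ q ≈ₚ p′ *ₚ q′
  *ₚ-cong {p} {q′ = q′} e f = ≈ₚ-trans (*ₚ-congʳ p f) (*ₚ-congˡ q′ e)

  module ≈ₚ-Reasoning = Relation.Binary.Reasoning.Setoid ≈ₚ-setoid

  scaleₚ-*ₚ : ∀ a q r → scaleₚ a q *ₚ r ≈ₚ scaleₚ a (q *ₚ r)
  scaleₚ-*ₚ a []      r = ≈ₚ-refl
  scaleₚ-*ₚ a (c ∷ q) r = begin
    scaleₚ (a *ℤ c) r +ₚ (0ℤ ∷ (scaleₚ a q *ₚ r))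
      ≈⟨ +ₚ-cong (≈ₚ-sym (scaleₚ-scaleₚ a c r)) (∷-cong (≡.sym (ℤ.*-zeroʳ a)) (scaleₚ-*ₚ a q r)) ⟩
    scaleₚ a (scaleₚ c r) +ₚ scaleₚ a (0ℤ ∷ (q *ₚ r))
      ≈⟨ scaleₚ-+ₚ a (scaleₚ c r) (0ℤ ∷ (q *ₚ r)) ⟨
    scaleₚ a (scaleₚ c r +ₚ (0ℤ ∷ (q *ₚ r)))
      ∎
    where open ≈ₚ-Reasoning

  *ₚ-distribʳ : ∀ r p q → (p +ₚ q) *ₚ r ≈ₚ (p *ₚ r) +ₚ (q *ₚ r)
  *ₚ-distribʳ r []      q       = ≈ₚ-refl
  *ₚ-distribʳ r (a ∷ p) []      = ≈ₚ-sym (+ₚ-identityʳ _)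
  *ₚ-distribʳ r (a ∷ p) (b ∷ q) = begin
    scaleₚ (a +ℤ b) r +ₚ (0ℤ ∷ ((p +ₚ q) *ₚ r))
      ≈⟨ +ₚ-cong (+-scaleₚ a b r) (∷-cong refl (*ₚ-distribʳ r p q)) ⟩
    (scaleₚ a r +ₚ scaleₚ b r) +ₚ ((0ℤ ∷ (p *ₚ r)) +ₚ (0ℤ ∷ (q *ₚ r)))
      ≈⟨ interchange (scaleₚ a r) (scaleₚ b r) (0ℤ ∷ (p *ₚ r)) (0ℤ ∷ (q *ₚ r)) ⟩
    (scaleₚ a r +ₚ (0ℤ ∷ (p *ₚ r))) +ₚ (scaleₚ b r +ₚ (0ℤ ∷ (q *ₚ r)))
      ∎
    where open ≈ₚ-Reasoning

  *ₚ-distribˡ : ∀ p q r → p *ₚ (q +ₚ r) ≈ₚ (p *ₚ q) +ₚ (p *ₚ r)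
  *ₚ-distribˡ p q r = begin
    p *ₚ (q +ₚ r)         ≈⟨ *ₚ-comm p (q +ₚ r) ⟩
    (q +ₚ r) *ₚ p         ≈⟨ *ₚ-distribʳ p q r ⟩
    (q *ₚ p) +ₚ (r *ₚ p) ≈⟨ +ₚ-cong (*ₚ-comm q p) (*ₚ-comm r p) ⟩
    (p *ₚ q) +ₚ (p *ₚ r) ∎
    where open ≈ₚ-Reasoning

  0∷-*ₚ : ∀ p q → (0ℤ ∷ p) *ₚ q ≈ₚ 0ℤ ∷ (p *ₚ q)
  0∷-*ₚ p q = +ₚ-congʳ (0ℤ ∷ (p *ₚ q)) (scaleₚ-0 q)

  *ₚ-assoc : ∀ p q r → (p *ₚ q) *ₚ r ≈ₚ p *ₚ (q *ₚ r)
  *ₚ-assoc []      q r = ≈ₚ-refl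
  *ₚ-assoc (a ∷ p) q r = begin
    (scaleₚ a q +ₚ (0ℤ ∷ (p *ₚ q))) *ₚ r
      ≈⟨ *ₚ-distribʳ r (scaleₚ a q) (0ℤ ∷ (p *ₚ q)) ⟩
    (scaleₚ a q *ₚ r) +ₚ ((0ℤ ∷ (p *ₚ q)) *ₚ r)
      ≈⟨ +ₚ-cong (scaleₚ-*ₚ a q r) (≈ₚ-trans (0∷-*ₚ (p *ₚ q) r) (∷-cong refl (*ₚ-assoc p q r))) ⟩
    scaleₚ a (q *ₚ r) +ₚ (0ℤ ∷ (p *ₚ (q *ₚ r)))
      ∎
    where open ≈ₚ-Reasoning

  *ₚ-identityˡ : ∀ p → 1ₚ *ₚ p ≈ₚ p
  *ₚ-identityˡ p = ≈ₚ-trans (+ₚ-cong (scaleₚ-1 p) (0∷-≈0 ≈ₚ-refl)) (+ₚ-identityʳ p)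

  ring : CommutativeRing 0ℓ 0ℓ
  ring = record
    { isCommutativeRing = record
      { isRing = record
        { +-isAbelianGroup = +ₚ-isAbelianGroup
        ; *-cong           = *ₚ-cong
        ; *-assoc          = *ₚ-assoc
        ; *-identity       = *ₚ-identityˡ , λ p → ≈ₚ-trans (*ₚ-comm p 1ₚ) (*ₚ-identityˡ p)
        ; distrib          = *ₚ-distribˡ , *ₚ-distribʳ
        }
      ; *-comm = *ₚ-comm
      }
    }

  ∂ₖ : ℕ → Poly → Poly
  ∂ₖ k []      = []
  ∂ₖ k (a ∷ p) = (+ k *ℤ a) ∷ ∂ₖ (suc k) p

  ∂ : Poly → Poly
  ∂ []      = []
  ∂ (a ∷ p) = ∂ₖ 1 p

  coeff-∂ₖ : ∀ k p j → coeff (∂ₖ k p) j ≡ + (k ℕ.+ j) *ℤ coeff p j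
  coeff-∂ₖ k []      j       = sym (ℤ.*-zeroʳ (+ (k ℕ.+ j)))
  coeff-∂ₖ k (a ∷ p) zero    = cong (λ m → + m *ℤ a) (sym (ℕ.+-identityʳ k))
  coeff-∂ₖ k (a ∷ p) (suc j) = trans (coeff-∂ₖ (suc k) p j) (cong (λ m → + m *ℤ coeff p j) (sym (ℕ.+-suc k j)))

  coeff-∂ : ∀ p j → coeff (∂ p) j ≡ + suc j *ℤ coeff p (suc j)
  coeff-∂ []      j = sym (ℤ.*-zeroʳ (+ suc j))
  coeff-∂ (a ∷ p) j = coeff-∂ₖ 1 p j

  ∂-cong : ∀ {p q} → p ≈ₚ q → ∂ p ≈ₚ ∂ q
  ∂-cong {p} {q} e = mk≈ λ j →
    trans (coeff-∂ p j) (trans (cong (+ suc j *ℤ_) (at e (suc j))) (sym (coeff-∂ q j)))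

  ∂-+ₚ : ∀ p q → ∂ (p +ₚ q) ≈ₚ ∂ p +ₚ ∂ q
  ∂-+ₚ p q = mk≈ λ j → begin
    coeff (∂ (p +ₚ q)) j                                      ≡⟨ coeff-∂ (p +ₚ q) j ⟩
    + suc j *ℤ coeff (p +ₚ q) (suc j)                         ≡⟨ cong (+ suc j *ℤ_) (coeff-+ₚ p q (suc j)) ⟩
    + suc j *ℤ (coeff p (suc j) +ℤ coeff q (suc j))           ≡⟨ ℤ.*-distribˡ-+ (+ suc j) (coeff p (suc j)) _ ⟩
    + suc j *ℤ coeff p (suc j) +ℤ + suc j *ℤ coeff q (suc j)  ≡⟨ cong₂ _+ℤ_ (coeff-∂ p j) (coeff-∂ q j) ⟨
    coeff (∂ p) j +ℤ coeff (∂ q) j                            ≡⟨ coeff-+ₚ (∂ p) (∂ q) j ⟨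
    coeff (∂ p +ₚ ∂ q) j                                      ∎
    where open ≡.≡-Reasoning

  ∂-scaleₚ : ∀ a p → ∂ (scaleₚ a p) ≈ₚ scaleₚ a (∂ p)
  ∂-scaleₚ a p = mk≈ λ j → begin
    coeff (∂ (scaleₚ a p)) j                 ≡⟨ coeff-∂ (scaleₚ a p) j ⟩
    + suc j *ℤ coeff (scaleₚ a p) (suc j)    ≡⟨ cong (+ suc j *ℤ_) (coeff-scaleₚ a p (suc j)) ⟩
    + suc j *ℤ (a *ℤ coeff p (suc j))        ≡⟨ swap (+ suc j) a (coeff p (suc j)) ⟩
    a *ℤ (+ suc j *ℤ coeff p (suc j))        ≡⟨ cong (a *ℤ_) (coeff-∂ p j) ⟨
    a *ℤ coeff (∂ p) j                       ≡⟨ coeff-scaleₚ a (∂ p) j ⟨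
    coeff (scaleₚ a (∂ p)) j                 ∎
    where
    open ≡.≡-Reasoning
    swap : ∀ x y z → x *ℤ (y *ℤ z) ≡ y *ℤ (x *ℤ z)
    swap = solve-∀

  ∂-∷ : ∀ a p → ∂ (a ∷ p) ≈ₚ p +ₚ (0ℤ ∷ ∂ p)
  ∂-∷ a p = mk≈ λ j → trans (coeff-∂ (a ∷ p) j) (sym (trans (coeff-+ₚ p (0ℤ ∷ ∂ p) j) (shifted j)))
    where
    open ≡.≡-Reasoning
    shifted : ∀ j → coeff p j +ℤ coeff (0ℤ ∷ ∂ p) j ≡ + suc j *ℤ coeff p j
    shifted zero    = trans (ℤ.+-identityʳ _) (sym (ℤ.*-identityˡ _))
    shifted (suc j) = begin
      c +ℤ coeff (∂ p) j           ≡⟨ cong (c +ℤ_) (coeff-∂ p j) ⟩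
      c +ℤ + suc j *ℤ c            ≡⟨ cong (_+ℤ + suc j *ℤ c) (ℤ.*-identityˡ c) ⟨
      1ℤ *ℤ c +ℤ + suc j *ℤ c      ≡⟨ ℤ.*-distribʳ-+ c 1ℤ (+ suc j) ⟨
      + suc (suc j) *ℤ c           ∎
      where c = coeff p (suc j)

  ∂-*ₚ : ∀ p q → ∂ (p *ₚ q) ≈ₚ (∂ p *ₚ q) +ₚ (p *ₚ ∂ q)
  ∂-*ₚ []      q = ≈ₚ-refl
  ∂-*ₚ (a ∷ p) q = begin
    ∂ (scaleₚ a q +ₚ (0ℤ ∷ (p *ₚ q)))
      ≈⟨ ∂-+ₚ (scaleₚ a q) (0ℤ ∷ (p *ₚ q)) ⟩
    ∂ (scaleₚ a q) +ₚ ∂ (0ℤ ∷ (p *ₚ q))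
      ≈⟨ +ₚ-cong (∂-scaleₚ a q)
                 (≈ₚ-trans (∂-∷ 0ℤ (p *ₚ q)) (+ₚ-congˡ (p *ₚ q) (∷-cong refl (∂-*ₚ p q)))) ⟩
    scaleₚ a (∂ q) +ₚ ((p *ₚ q) +ₚ ((0ℤ ∷ (∂ p *ₚ q)) +ₚ (0ℤ ∷ (p *ₚ ∂ q))))
      ≈⟨ +ₚ-congˡ (scaleₚ a (∂ q))
                  (≈ₚ-sym (+ₚ-assoc (p *ₚ q) (0ℤ ∷ (∂ p *ₚ q)) (0ℤ ∷ (p *ₚ ∂ q)))) ⟩
    scaleₚ a (∂ q) +ₚ (((p *ₚ q) +ₚ (0ℤ ∷ (∂ p *ₚ q))) +ₚ (0ℤ ∷ (p *ₚ ∂ q)))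
      ≈⟨ x∙yz≈y∙xz (scaleₚ a (∂ q)) ((p *ₚ q) +ₚ (0ℤ ∷ (∂ p *ₚ q))) (0ℤ ∷ (p *ₚ ∂ q)) ⟩
    ((p *ₚ q) +ₚ (0ℤ ∷ (∂ p *ₚ q))) +ₚ ((a ∷ p) *ₚ ∂ q)
      ≈⟨ +ₚ-congʳ ((a ∷ p) *ₚ ∂ q)
                  (≈ₚ-trans (*ₚ-distribʳ q p (0ℤ ∷ ∂ p)) (+ₚ-congˡ (p *ₚ q) (0∷-*ₚ (∂ p) q))) ⟨
    ((p +ₚ (0ℤ ∷ ∂ p)) *ₚ q) +ₚ ((a ∷ p) *ₚ ∂ q)
      ≈⟨ +ₚ-congʳ ((a ∷ p) *ₚ ∂ q) (*ₚ-congˡ q (∂-∷ a p)) ⟨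
    (∂ (a ∷ p) *ₚ q) +ₚ ((a ∷ p) *ₚ ∂ q)
      ∎
    where open ≈ₚ-Reasoning

  record DegreeAtMost (a : ℕ) (p : Poly) : Set where
    constructor degree≤
    field vanishes : ∀ j → a < j → coeff p j ≡ 0ℤ
  open DegreeAtMost public

  degree-+ₚ : ∀ {a p q} → DegreeAtMost a p → DegreeAtMost a q → DegreeAtMost a (p +ₚ q)
  degree-+ₚ {p = p} {q} dp dq = degree≤ λ j a<j →
    trans (coeff-+ₚ p q j) (cong₂ _+ℤ_ (vanishes dp j a<j) (vanishes dq j a<j))

  degree--ₚ : ∀ {a p} → DegreeAtMost a p → DegreeAtMost a (-ₚ p)
  degree--ₚ {p = p} dp = degree≤ λ j a<j → trans (coeff--ₚ p j) (cong -_ (vanishes dp j a<j))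

  degree-cong : ∀ {a p q} → p ≈ₚ q → DegreeAtMost a p → DegreeAtMost a q
  degree-cong p≈q dp = degree≤ λ j a<j → trans (sym (at p≈q j)) (vanishes dp j a<j)

  degree-tail : ∀ {a c p} → DegreeAtMost (suc a) (c ∷ p) → DegreeAtMost a p
  degree-tail d = degree≤ λ j a<j → vanishes d (suc j) (s≤s a<j)

  degree-0-tail : ∀ {c p} → DegreeAtMost 0 (c ∷ p) → p ≈ₚ 0ₚ
  degree-0-tail d = mk≈ λ j → vanishes d (suc j) (s≤s z≤n)

  coeff-∷*ₚ : ∀ c p q j → coeff ((c ∷ p) *ₚ q) j ≡ c *ℤ coeff q j +ℤ coeff (0ℤ ∷ (p *ₚ q)) j
  coeff-∷*ₚ c p q j = trans (coeff-+ₚ (scaleₚ c q) (0ℤ ∷ (p *ₚ q)) j) (cong (_+ℤ _) (coeff-scaleₚ c q j))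

  degree-*ₚ : ∀ {a b} p q → DegreeAtMost a p → DegreeAtMost b q → DegreeAtMost (a ℕ.+ b) (p *ₚ q)
  degree-*ₚ         []      q dp dq = degree≤ λ j a+b<j → refl
  degree-*ₚ {a} {b} (c ∷ p) q dp dq = degree≤ λ j a+b<j → trans (coeff-∷*ₚ c p q j)
    (cong₂ _+ℤ_ (trans (cong (c *ℤ_) (vanishes dq j (ℕ.≤-trans (s≤s (ℕ.m≤n+m b a)) a+b<j))) (ℤ.*-zeroʳ c))
                (shifted a j a+b<j dp))
    where
    shifted : ∀ a j → a ℕ.+ b < j → DegreeAtMost a (c ∷ p) → coeff (0ℤ ∷ (p *ₚ q)) j ≡ 0ℤ
    shifted zero    (suc j) a+b<j       dp′ = at (*ₚ-congˡ q (degree-0-tail dp′)) j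
    shifted (suc a) (suc j) (s≤s a+b<j) dp′ = vanishes (degree-*ₚ p q (degree-tail dp′) dq) j a+b<j

  coeff-*ₚ-top : ∀ a b p q → DegreeAtMost a p → DegreeAtMost b q →
                 coeff (p *ₚ q) (a ℕ.+ b) ≡ coeff p a *ℤ coeff q b
  coeff-*ₚ-top a       b []      q dp dq = sym (ℤ.*-zeroˡ (coeff q b))
  coeff-*ₚ-top zero    b (c ∷ p) q dp dq = begin
    coeff ((c ∷ p) *ₚ q) b                          ≡⟨ coeff-∷*ₚ c p q b ⟩
    c *ℤ coeff q b +ℤ coeff (0ℤ ∷ (p *ₚ q)) b       ≡⟨ cong (c *ℤ coeff q b +ℤ_) (shifted b) ⟩
    c *ℤ coeff q b +ℤ 0ℤ                            ≡⟨ ℤ.+-identityʳ _ ⟩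
    c *ℤ coeff q b                                  ∎
    where
    open ≡.≡-Reasoning
    shifted : ∀ b → coeff (0ℤ ∷ (p *ₚ q)) b ≡ 0ℤ
    shifted zero    = refl
    shifted (suc b) = at (*ₚ-congˡ q (degree-0-tail dp)) b
  coeff-*ₚ-top (suc a) b (c ∷ p) q dp dq = begin
    coeff ((c ∷ p) *ₚ q) (suc (a ℕ.+ b))                 ≡⟨ coeff-∷*ₚ c p q (suc (a ℕ.+ b)) ⟩
    c *ℤ coeff q (suc (a ℕ.+ b)) +ℤ coeff (p *ₚ q) (a ℕ.+ b)
      ≡⟨ cong₂ _+ℤ_ (trans (cong (c *ℤ_) (vanishes dq (suc (a ℕ.+ b)) (s≤s (ℕ.m≤n+m b a)))) (ℤ.*-zeroʳ c))
                    (coeff-*ₚ-top a b p q (degree-tail dp) dq) ⟩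
    0ℤ +ℤ coeff p a *ℤ coeff q b                         ≡⟨ ℤ.+-identityˡ _ ⟩
    coeff p a *ℤ coeff q b                               ∎
    where open ≡.≡-Reasoning

  coeff-≥length : ∀ p j → length p ≤ j → coeff p j ≡ 0ℤ
  coeff-≥length []      j       _           = refl
  coeff-≥length (a ∷ p) (suc j) (s≤s len≤j) = coeff-≥length p j len≤j

  -- Descending induction on the degree of r: its top coefficient reappears in d r.
  d*r≈0⇒r≈0 : ∀ n d r → DegreeAtMost n d → coeff d n ≡ 1ℤ → d *ₚ r ≈ₚ 0ₚ → r ≈ₚ 0ₚ
  d*r≈0⇒r≈0 n d r deg monic dr≈0 = go (length r) (coeff-≥length r)
    where
    go : ∀ L → (∀ j → L ≤ j → coeff r j ≡ 0ℤ) → r ≈ₚ 0ₚ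
    go zero    vanish = mk≈ λ j → vanish j z≤n
    go (suc L) vanish = go L vanish′
      where
      top : coeff r L ≡ 0ℤ
      top = begin
        coeff r L                  ≡⟨ ℤ.*-identityˡ (coeff r L) ⟨
        1ℤ *ℤ coeff r L            ≡⟨ cong (_*ℤ coeff r L) monic ⟨
        coeff d n *ℤ coeff r L     ≡⟨ coeff-*ₚ-top n L d r deg (degree≤ vanish) ⟨
        coeff (d *ₚ r) (n ℕ.+ L)   ≡⟨ at dr≈0 (n ℕ.+ L) ⟩
        0ℤ                         ∎
        where open ≡.≡-Reasoning
      vanish′ : ∀ j → L ≤ j → coeff r j ≡ 0ℤ
      vanish′ j L≤j with ℕ.m≤n⇒m<n∨m≡n L≤j
      ... | inj₁ L<j  = vanish j L<j
      ... | inj₂ refl = top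

  *ₚ-cancelʳ-monic : ∀ n d {p q} → DegreeAtMost n d → coeff d n ≡ 1ℤ → p *ₚ d ≈ₚ q *ₚ d → p ≈ₚ q
  *ₚ-cancelʳ-monic n d {p} {q} deg monic pd≈qd =
    x∙y⁻¹≈ε⇒x≈y p q (d*r≈0⇒r≈0 n d (p +ₚ (-ₚ q)) deg monic (begin
      d *ₚ (p +ₚ (-ₚ q))              ≈⟨ *ₚ-comm d (p +ₚ (-ₚ q)) ⟩
      (p +ₚ (-ₚ q)) *ₚ d              ≈⟨ *ₚ-distribʳ d p (-ₚ q) ⟩
      (p *ₚ d) +ₚ ((-ₚ q) *ₚ d)       ≈⟨ +ₚ-congˡ (p *ₚ d) (scaleₚ-*ₚ (- 1ℤ) q d) ⟩
      (p *ₚ d) +ₚ (-ₚ (q *ₚ d))       ≈⟨ x≈y⇒x∙y⁻¹≈ε pd≈qd ⟩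
      0ₚ                              ∎))
    where open ≈ₚ-Reasoning

module Determinant {ℓ} (R : CommutativeRing 0ℓ ℓ) where

  open CommutativeRing R renaming (Carrier to C) hiding (zero)
  open import Algebra.Properties.Ring ring
    using (-‿distribˡ-*; -‿distribʳ-*; -‿involutive; -‿anti-homo-+; -0#≈0#)
  open import Algebra.Properties.CommutativeSemigroup *-commutativeSemigroup
    using () renaming (x∙yz≈y∙xz to *-swap)
  open import Algebra.Solver.CommutativeMonoid +-commutativeMonoid using (solve; _⊕_; _⊜_)
  open import Algebra.Properties.Semiring.Sum semiring
    using (sum; sum-cong-≋; sum-replicate-zero; ∑-distrib-+; *-distribˡ-sum; *-distribʳ-sum)
    renaming (∑-comm to sum-comm)
  open import Data.Fin using (_≟_)
  open import Data.Fin.Properties using (punchInᵢ≢i)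
  open import Relation.Nullary using (yes; no)
  open import Algebra.Properties.AbelianGroup +-abelianGroup using (inverseˡ-unique)
  open import Data.Vec.Functional using (updateAt)
  open import Data.Vec.Functional.Properties
    using (updateAt-updates; updateAt-minimal; updateAt-id-local; updateAt-commutes; map-updateAt-local)
  open import Data.List using (tabulate)
  open import Function using (_∘_; const; _$_)
  open import Relation.Binary.Reasoning.Setoid setoid

  open Det 0# 1# _+_ _*_ -_ public

  -- Opaque, so that the summand can still be inferred from a sum over suc n.
  opaque
    infix 5 ∑
    ∑ : ∀ n → (Fin n → C) → C
    ∑ n f = sum f

    syntax ∑ n (λ j → x) = ∑[ j < n ] x

    ∑-suc : ∀ n (f : Fin (suc n) → C) → ∑[ j < suc n ] f j ≈ f zero + (∑[ j < n ] f (suc j))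
    ∑-suc n f = refl

    ∑-cong : ∀ n {f g : Fin n → C} → (∀ j → f j ≈ g j) → ∑ n f ≈ ∑ n g
    ∑-cong n = sum-cong-≋

    ∑-zero : ∀ n {f : Fin n → C} → (∀ j → f j ≈ 0#) → ∑ n f ≈ 0#
    ∑-zero n e = trans (sum-cong-≋ e) (sum-replicate-zero n)

    ∑-+ : ∀ n (f g : Fin n → C) → ∑[ j < n ] f j + g j ≈ ∑ n f + ∑ n g
    ∑-+ n = ∑-distrib-+

    ∑-comm : ∀ m n (f : Fin m → Fin n → C) → ∑[ i < m ] ∑[ j < n ] f i j ≈ ∑[ j < n ] ∑[ i < m ] f i j
    ∑-comm m n = sum-comm

    *-distribˡ-∑ : ∀ n x (f : Fin n → C) → x * (∑ n f) ≈ ∑[ j < n ] x * f j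
    *-distribˡ-∑ n = *-distribˡ-sum

    *-distribʳ-∑ : ∀ n x (f : Fin n → C) → (∑ n f) * x ≈ ∑[ j < n ] f j * x
    *-distribʳ-∑ n = *-distribʳ-sum

  ∑-neg : ∀ n (f : Fin n → C) → ∑[ j < n ] - f j ≈ - ∑ n f
  ∑-neg zero    f = trans (∑-zero zero (λ ())) (trans (sym -0#≈0#) (-‿cong (sym (∑-zero zero (λ ())))))
  ∑-neg (suc n) f = begin
    ∑[ j < suc n ] - f j                   ≈⟨ ∑-suc n _ ⟩
    - f zero + (∑[ j < n ] - f (suc j))   ≈⟨ +-congˡ (∑-neg n (f ∘ suc)) ⟩
    - f zero + - ∑ n (f ∘ suc)            ≈⟨ -‿anti-homo-+ (∑ n (f ∘ suc)) (f zero) ⟨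
    - (∑ n (f ∘ suc) + f zero)            ≈⟨ -‿cong (trans (+-comm _ _) (sym (∑-suc n f))) ⟩
    - ∑ (suc n) f                         ∎

  sign : ∀ {n} → Fin n → C
  sign zero    = 1#
  sign (suc j) = - sign j

  altSum-tabulate : ∀ n (f : Fin n → C) → altSum (tabulate f) ≈ ∑[ j < n ] sign j * f j
  altSum-tabulate zero    f = sym (∑-zero zero (λ ()))
  altSum-tabulate (suc n) f = begin
    f zero + - altSum (tabulate (f ∘ suc))            ≈⟨ +-cong (sym (*-identityˡ (f zero)))
                                                           (-‿cong (altSum-tabulate n (f ∘ suc))) ⟩
    1# * f zero + - (∑[ j < n ] sign j * f (suc j))   ≈⟨ +-congˡ (∑-neg n _) ⟨
    1# * f zero + (∑[ j < n ] - (sign j * f (suc j))) ≈⟨ +-congˡ (∑-cong n (λ j → -‿distribˡ-* _ _)) ⟩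
    1# * f zero + (∑[ j < n ] - sign j * f (suc j))   ≈⟨ ∑-suc n _ ⟨
    ∑[ j < suc n ] sign j * f j                       ∎

  altSum-cong : ∀ n {f g : Fin n → C} → (∀ j → f j ≈ g j) → altSum (tabulate f) ≈ altSum (tabulate g)
  altSum-cong n {f} {g} f≈g = begin
    altSum (tabulate f)         ≈⟨ altSum-tabulate n f ⟩
    ∑[ j < n ] sign j * f j     ≈⟨ ∑-cong n (λ j → *-congˡ (f≈g j)) ⟩
    ∑[ j < n ] sign j * g j     ≈⟨ altSum-tabulate n g ⟨
    altSum (tabulate g)         ∎

  det-suc : ∀ n (M : Matrix C (suc n)) →
            det (suc n) M ≈ ∑[ j < suc n ] sign j * (M zero j * det n (minor j M))
  det-suc n M = altSum-tabulate (suc n) (λ j → M zero j * det n (minor j M))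

  det-cong : ∀ n {M N : Matrix C n} → (∀ i j → M i j ≈ N i j) → det n M ≈ det n N
  det-cong zero    e = refl
  det-cong (suc n) e = altSum-cong (suc n) (λ j → *-cong (e zero j) (det-cong n (λ i l → e (suc i) (punchIn j l))))

  det-cong-≗ : ∀ n {M N : Matrix C n} → (∀ i → M i ≡ N i) → det n M ≈ det n N
  det-cong-≗ n e = det-cong n (λ i j → reflexive (≡.cong (_$ j) (e i)))

  δ : ∀ {n} → Fin n → Fin n → C
  δ zero    zero    = 1#
  δ zero    (suc _) = 0#
  δ (suc _) zero    = 0#
  δ (suc i) (suc j) = δ i j

  δ-refl : ∀ {n} (i : Fin n) → δ i i ≈ 1#
  δ-refl zero    = refl
  δ-refl (suc i) = δ-refl i

  δ-≢ : ∀ {n} {i j : Fin n} → i ≢ j → δ i j ≈ 0#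
  δ-≢ {i = zero}  {zero}  i≢j = contradiction ≡.refl i≢j
  δ-≢ {i = zero}  {suc j} i≢j = refl
  δ-≢ {i = suc i} {zero}  i≢j = refl
  δ-≢ {i = suc i} {suc j} i≢j = δ-≢ (i≢j ∘ ≡.cong suc)

  δ-sym : ∀ {n} (i j : Fin n) → δ i j ≈ δ j i
  δ-sym zero    zero    = refl
  δ-sym zero    (suc j) = refl
  δ-sym (suc i) zero    = refl
  δ-sym (suc i) (suc j) = δ-sym i j

  ∑-*δ : ∀ n (f : Fin n → C) k → ∑[ j < n ] f j * δ j k ≈ f k
  ∑-*δ (suc n) f zero    = begin
    ∑[ j < suc n ] f j * δ j zero              ≈⟨ ∑-suc n _ ⟩
    f zero * 1# + (∑[ j < n ] f (suc j) * 0#)  ≈⟨ +-cong (*-identityʳ _) (∑-zero n (λ j → zeroʳ _)) ⟩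
    f zero + 0#                                ≈⟨ +-identityʳ (f zero) ⟩
    f zero                                     ∎
  ∑-*δ (suc n) f (suc k) = begin
    ∑[ j < suc n ] f j * δ j (suc k)              ≈⟨ ∑-suc n _ ⟩
    f zero * 0# + (∑[ j < n ] f (suc j) * δ j k)  ≈⟨ +-cong (zeroʳ (f zero)) (∑-*δ n (f ∘ suc) k) ⟩
    0# + f (suc k)                                ≈⟨ +-identityˡ (f (suc k)) ⟩
    f (suc k)                                     ∎

  ∑-δ* : ∀ n (f : Fin n → C) k → ∑[ j < n ] δ k j * f j ≈ f k
  ∑-δ* n f k = trans (∑-cong n (λ j → trans (*-comm (δ k j) (f j)) (*-congˡ (δ-sym k j)))) (∑-*δ n f k)

  det-identity : ∀ n → det n δ ≈ 1#
  det-identity zero    = refl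
  det-identity (suc n) = begin
    det (suc n) δ                                          ≈⟨ det-suc n δ ⟩
    ∑[ j < suc n ] sign j * (δ zero j * det n (minor j δ)) ≈⟨ ∑-cong (suc n) (λ j → *-swap _ _ _) ⟩
    ∑[ j < suc n ] δ zero j * (sign j * det n (minor j δ)) ≈⟨ ∑-δ* (suc n) _ zero ⟩
    1# * det n δ                                           ≈⟨ *-identityˡ _ ⟩
    det n δ                                                ≈⟨ det-identity n ⟩
    1#                                                     ∎

  ∑-δ-reindex : ∀ m n (v : Fin n → C) (g : Fin m → Fin n) (e : Fin m → C) →
                ∑[ k < n ] v k * (∑[ l < m ] δ k (g l) * e l) ≈ ∑[ l < m ] v (g l) * e l
  ∑-δ-reindex m n v g e = begin
    ∑[ k < n ] v k * (∑[ l < m ] δ k (g l) * e l)    ≈⟨ ∑-cong n (λ k → *-distribˡ-∑ m (v k) _) ⟩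
    ∑[ k < n ] ∑[ l < m ] v k * (δ k (g l) * e l)    ≈⟨ ∑-comm n m _ ⟩
    ∑[ l < m ] ∑[ k < n ] v k * (δ k (g l) * e l)    ≈⟨ ∑-cong m (λ l → ∑-cong n (λ k → *-assoc _ _ _)) ⟨
    ∑[ l < m ] ∑[ k < n ] (v k * δ k (g l)) * e l    ≈⟨ ∑-cong m (λ l → *-distribʳ-∑ n (e l) _) ⟨
    ∑[ l < m ] (∑[ k < n ] v k * δ k (g l)) * e l    ≈⟨ ∑-cong m (λ l → *-congʳ (∑-*δ n v (g l))) ⟩
    ∑[ l < m ] v (g l) * e l                          ∎

  infixl 5 _[_]≔_
  _[_]≔_ : ∀ {n} → Matrix C n → Fin n → (Fin n → C) → Matrix C n
  M [ r ]≔ v = updateAt M r (const v)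

  minor-[]≔ : ∀ {n} (M : Matrix C (suc n)) r v j i →
              minor j (M [ suc r ]≔ v) i ≡ (minor j M [ r ]≔ v ∘ punchIn j) i
  minor-[]≔ M r v j i = map-updateAt-local {f = _∘ punchIn j} (M ∘ suc) r ≡.refl i

  cofactor : ∀ {n} → Matrix C n → Fin n → Fin n → C
  cofactor {n} M r k = det n (M [ r ]≔ δ k)

  det-expandRow : ∀ n (M : Matrix C n) r v → det n (M [ r ]≔ v) ≈ ∑[ k < n ] v k * cofactor M r k
  det-expandRow (suc n) M zero v = begin
    det (suc n) (M [ zero ]≔ v)              ≈⟨ det-suc n (M [ zero ]≔ v) ⟩
    ∑[ j < suc n ] sign j * (v j * D j)      ≈⟨ ∑-cong (suc n) (λ j → trans (*-swap (sign j) (v j) (D j))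
                                                                   (*-congˡ (sym (cofactor-zero j)))) ⟩
    ∑[ k < suc n ] v k * cofactor M zero k   ∎
    where
    D : Fin (suc n) → C
    D j = det n (minor j M)
    cofactor-zero : ∀ k → cofactor M zero k ≈ sign k * D k
    cofactor-zero k = begin
      cofactor M zero k                        ≈⟨ det-suc n (M [ zero ]≔ δ k) ⟩
      ∑[ j < suc n ] sign j * (δ k j * D j)    ≈⟨ ∑-cong (suc n) (λ j → *-swap (sign j) (δ k j) (D j)) ⟩
      ∑[ j < suc n ] δ k j * (sign j * D j)    ≈⟨ ∑-δ* (suc n) (λ j → sign j * D j) k ⟩
      sign k * D k                             ∎
  det-expandRow (suc n) M (suc r) v = begin
    det (suc n) (M [ suc r ]≔ v)
      ≈⟨ expand v ⟩
    ∑[ j < suc n ] c j * (∑[ l < n ] v (punchIn j l) * E j l)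
      ≈⟨ ∑-cong (suc n) (λ j → *-congˡ (∑-δ-reindex n (suc n) v (punchIn j) (E j))) ⟨
    ∑[ j < suc n ] c j * (∑[ k < suc n ] v k * (∑[ l < n ] δ k (punchIn j l) * E j l))
      ≈⟨ ∑-cong (suc n) (λ j → trans (*-distribˡ-∑ (suc n) (c j) _) (∑-cong (suc n) (λ k → *-swap _ _ _))) ⟩
    ∑[ j < suc n ] ∑[ k < suc n ] v k * (c j * (∑[ l < n ] δ k (punchIn j l) * E j l))
      ≈⟨ ∑-comm (suc n) (suc n) _ ⟩
    ∑[ k < suc n ] ∑[ j < suc n ] v k * (c j * (∑[ l < n ] δ k (punchIn j l) * E j l))
      ≈⟨ ∑-cong (suc n) (λ k → trans (*-congˡ (expand (δ k))) (*-distribˡ-∑ (suc n) (v k) _)) ⟨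
    ∑[ k < suc n ] v k * cofactor M (suc r) k
      ∎
    where
    c : Fin (suc n) → C
    c j = sign j * M zero j
    E : Fin (suc n) → Fin n → C
    E j = cofactor (minor j M) r
    expand : ∀ w → det (suc n) (M [ suc r ]≔ w) ≈ ∑[ j < suc n ] c j * (∑[ l < n ] w (punchIn j l) * E j l)
    expand w = begin
      det (suc n) (M [ suc r ]≔ w)
        ≈⟨ det-suc n (M [ suc r ]≔ w) ⟩
      ∑[ j < suc n ] sign j * (M zero j * det n (minor j (M [ suc r ]≔ w)))
        ≈⟨ ∑-cong (suc n) (λ j → trans (*-congˡ (*-congˡ (det-cong-≗ n (minor-[]≔ M r w j))))
                                       (sym (*-assoc _ _ _))) ⟩
      ∑[ j < suc n ] c j * det n (minor j M [ r ]≔ w ∘ punchIn j)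
        ≈⟨ ∑-cong (suc n) (λ j → *-congˡ (det-expandRow n (minor j M) r (w ∘ punchIn j))) ⟩
      ∑[ j < suc n ] c j * (∑[ l < n ] w (punchIn j l) * E j l)
        ∎

  det-expand : ∀ n (M : Matrix C n) r → det n M ≈ ∑[ k < n ] M r k * cofactor M r k
  det-expand n M r = trans (sym (det-cong-≗ n (updateAt-id-local r M ≡.refl))) (det-expandRow n M r (M r))

  det-[]≔-cong : ∀ n (M : Matrix C n) r {v w} → (∀ k → v k ≈ w k) → det n (M [ r ]≔ v) ≈ det n (M [ r ]≔ w)
  det-[]≔-cong n M r e =
    trans (det-expandRow n M r _) (trans (∑-cong n (λ k → *-congʳ (e k))) (sym (det-expandRow n M r _)))

  det-[]≔-+ : ∀ n (M : Matrix C n) r v w →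
              det n (M [ r ]≔ (λ k → v k + w k)) ≈ det n (M [ r ]≔ v) + det n (M [ r ]≔ w)
  det-[]≔-+ n M r v w = begin
    det n (M [ r ]≔ (λ k → v k + w k))
      ≈⟨ det-expandRow n M r _ ⟩
    ∑[ k < n ] (v k + w k) * cofactor M r k
      ≈⟨ ∑-cong n (λ k → distribʳ _ _ _) ⟩
    ∑[ k < n ] v k * cofactor M r k + w k * cofactor M r k
      ≈⟨ ∑-+ n _ _ ⟩
    (∑[ k < n ] v k * cofactor M r k) + (∑[ k < n ] w k * cofactor M r k)
      ≈⟨ +-cong (det-expandRow n M r v) (det-expandRow n M r w) ⟨
    det n (M [ r ]≔ v) + det n (M [ r ]≔ w)
      ∎

  det-[]≔-neg : ∀ n (M : Matrix C n) r v → det n (M [ r ]≔ (λ k → - v k)) ≈ - det n (M [ r ]≔ v)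
  det-[]≔-neg n M r v = begin
    det n (M [ r ]≔ (λ k → - v k))        ≈⟨ det-expandRow n M r _ ⟩
    ∑[ k < n ] - v k * cofactor M r k     ≈⟨ ∑-cong n (λ k → sym (-‿distribˡ-* _ _)) ⟩
    ∑[ k < n ] - (v k * cofactor M r k)   ≈⟨ ∑-neg n _ ⟩
    - (∑[ k < n ] v k * cofactor M r k)   ≈⟨ -‿cong (det-expandRow n M r v) ⟨
    - det n (M [ r ]≔ v)                  ∎

  ∑∑-antisym : ∀ n (G : Fin n → Fin n → C) → (∀ j k → G j k ≈ - G k j) → (∀ j → G j j ≈ 0#) →
               ∑[ j < n ] ∑[ k < n ] G j k ≈ 0#
  ∑∑-antisym zero    G anti diag = ∑-zero zero (λ ())
  ∑∑-antisym (suc n) G anti diag = begin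
    ∑[ j < suc n ] ∑[ k < suc n ] G j k
      ≈⟨ trans (∑-suc n _) (+-cong (∑-suc n _) (∑-cong n (λ j → ∑-suc n _))) ⟩
    (G zero zero + X) + (∑[ j < n ] G (suc j) zero + (∑[ k < n ] G (suc j) (suc k)))
      ≈⟨ +-cong (+-congʳ (diag zero)) (∑-+ n _ _) ⟩
    (0# + X) + ((∑[ j < n ] G (suc j) zero) + (∑[ j < n ] ∑[ k < n ] G (suc j) (suc k)))
      ≈⟨ +-cong (+-identityˡ X) (+-cong (trans (∑-cong n (λ j → anti (suc j) zero)) (∑-neg n _))
                                       (∑∑-antisym n _ (λ j k → anti (suc j) (suc k)) (diag ∘ suc))) ⟩
    X + (- X + 0#)
      ≈⟨ trans (+-congˡ (+-identityʳ (- X))) (-‿inverseʳ X) ⟩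
    0#
      ∎
    where
    X = ∑[ k < n ] G zero (suc k)

  ∑< : ∀ n → (Fin n → Fin n → C) → C
  ∑< zero    G = 0#
  ∑< (suc n) G = (∑[ k < n ] G zero (suc k)) + ∑< n (λ j k → G (suc j) (suc k))

  ∑∑-sym : ∀ n (G : Fin n → Fin n → C) → (∀ j k → G j k ≈ G k j) →
           ∑[ j < n ] ∑[ k < n ] G j k ≈ (∑[ j < n ] G j j) + (∑< n G + ∑< n G)
  ∑∑-sym zero    G sym-G =
    trans (∑-zero zero (λ ())) (sym (trans (+-cong (∑-zero zero (λ ())) (+-identityʳ 0#)) (+-identityʳ 0#)))
  ∑∑-sym (suc n) G sym-G = begin
    ∑[ j < suc n ] ∑[ k < suc n ] G j k
      ≈⟨ trans (∑-suc n _) (+-cong (∑-suc n _) (∑-cong n (λ j → ∑-suc n _))) ⟩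
    (G zero zero + X) + (∑[ j < n ] G (suc j) zero + (∑[ k < n ] G (suc j) (suc k)))
      ≈⟨ +-congˡ (trans (∑-+ n _ _) (+-cong (∑-cong n (λ j → sym-G (suc j) zero))
                                            (∑∑-sym n _ (λ j k → sym-G (suc j) (suc k))))) ⟩
    (G zero zero + X) + (X + ((∑[ j < n ] G (suc j) (suc j)) + (T + T)))
      ≈⟨ solve 4 (λ a x d t → (a ⊕ x) ⊕ (x ⊕ (d ⊕ (t ⊕ t))) ⊜ (a ⊕ d) ⊕ ((x ⊕ t) ⊕ (x ⊕ t))) refl
                 (G zero zero) X (∑[ j < n ] G (suc j) (suc j)) T ⟩
    (G zero zero + (∑[ j < n ] G (suc j) (suc j))) + ((X + T) + (X + T))
      ≈⟨ +-congʳ (∑-suc n _) ⟨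
    (∑[ j < suc n ] G j j) + (∑< (suc n) G + ∑< (suc n) G)
      ∎
    where
    X = ∑[ k < n ] G zero (suc k)
    T = ∑< n (λ j k → G (suc j) (suc k))

  δ-punchIn-punchOut : ∀ {n} {j k : Fin (suc n)} (j≢k : j ≢ k) m → δ k (punchIn j m) ≈ δ (punchOut j≢k) m
  δ-punchIn-punchOut {j = zero}  {zero}  j≢k m = contradiction ≡.refl j≢k
  δ-punchIn-punchOut {j = zero}  {suc k} j≢k m = refl
  δ-punchIn-punchOut {suc n} {suc j} {zero}  j≢k zero    = refl
  δ-punchIn-punchOut {suc n} {suc j} {zero}  j≢k (suc m) = refl
  δ-punchIn-punchOut {suc n} {suc j} {suc k} j≢k zero    = refl
  δ-punchIn-punchOut {suc n} {suc j} {suc k} j≢k (suc m) = δ-punchIn-punchOut (j≢k ∘ ≡.cong suc) m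

  punchIn-punchIn-punchOut : ∀ {n} {j k : Fin (suc (suc n))} (j≢k : j ≢ k) (k≢j : k ≢ j) l →
                             punchIn j (punchIn (punchOut j≢k) l) ≡ punchIn k (punchIn (punchOut k≢j) l)
  punchIn-punchIn-punchOut {j = zero}  {zero}  j≢k k≢j l = contradiction ≡.refl j≢k
  punchIn-punchIn-punchOut {j = zero}  {suc k} j≢k k≢j l = ≡.refl
  punchIn-punchIn-punchOut {j = suc j} {zero}  j≢k k≢j l = ≡.refl
  punchIn-punchIn-punchOut {suc n} {suc j} {suc k} j≢k k≢j zero    = ≡.refl
  punchIn-punchIn-punchOut {suc n} {suc j} {suc k} j≢k k≢j (suc l) =
    ≡.cong suc (punchIn-punchIn-punchOut (j≢k ∘ ≡.cong suc) (k≢j ∘ ≡.cong suc) l)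

  -‿*-‿ : ∀ x y → - x * - y ≈ x * y
  -‿*-‿ x y = trans (sym (-‿distribˡ-* x (- y))) (trans (-‿cong (sym (-‿distribʳ-* x y))) (-‿involutive _))

  sign-punchOut : ∀ {n} {j k : Fin (suc n)} (j≢k : j ≢ k) (k≢j : k ≢ j) →
                  sign j * sign (punchOut j≢k) ≈ - (sign k * sign (punchOut k≢j))
  sign-punchOut {j = zero} {zero} j≢k k≢j = contradiction ≡.refl j≢k
  sign-punchOut {suc n} {zero}  {suc k} j≢k k≢j =
    trans (*-identityˡ _) (sym (trans (-‿cong (*-identityʳ _)) (-‿involutive _)))
  sign-punchOut {suc n} {suc j} {zero}  j≢k k≢j = trans (*-identityʳ _) (-‿cong (sym (*-identityˡ _)))
  sign-punchOut {suc n} {suc j} {suc k} j≢k k≢j =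
    trans (-‿*-‿ _ _) (trans (sign-punchOut (j≢k ∘ ≡.cong suc) (k≢j ∘ ≡.cong suc))
                             (-‿cong (sym (-‿*-‿ _ _))))

  module FirstTwoRows {n} (M : Matrix C (suc (suc n))) where

    det-unitRows : Fin (suc (suc n)) → Fin (suc (suc n)) → C
    det-unitRows j k = det (suc (suc n)) (M [ zero ]≔ δ j [ suc zero ]≔ δ k)

    minor₂ : Fin (suc (suc n)) → Fin (suc n) → C
    minor₂ j m = det n (λ i l → M (suc (suc i)) (punchIn j (punchIn m l)))

    det-unitRows-expand : ∀ j k →
      det-unitRows j k ≈ sign j * (∑[ m < suc n ] sign m * (δ k (punchIn j m) * minor₂ j m))
    det-unitRows-expand j k = begin
      det-unitRows j k
        ≈⟨ det-suc (suc n) P ⟩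
      ∑[ l < suc (suc n) ] sign l * (δ j l * det (suc n) (minor l P))
        ≈⟨ ∑-cong (suc (suc n)) (λ l → *-swap (sign l) (δ j l) _) ⟩
      ∑[ l < suc (suc n) ] δ j l * (sign l * det (suc n) (minor l P))
        ≈⟨ ∑-δ* (suc (suc n)) _ j ⟩
      sign j * det (suc n) (minor j P)
        ≈⟨ *-congˡ (det-suc n (minor j P)) ⟩
      sign j * (∑[ m < suc n ] sign m * (δ k (punchIn j m) * minor₂ j m))
        ∎
      where P = M [ zero ]≔ δ j [ suc zero ]≔ δ k

    det-unitRows-refl : ∀ j → det-unitRows j j ≈ 0#
    det-unitRows-refl j = begin
      det-unitRows j j
        ≈⟨ det-unitRows-expand j j ⟩
      sign j * (∑[ m < suc n ] sign m * (δ j (punchIn j m) * minor₂ j m))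
        ≈⟨ *-congˡ (∑-zero (suc n) (λ m → trans (*-congˡ (trans (*-congʳ (δ-≢ (punchInᵢ≢i j m ∘ ≡.sym)))
                                                              (zeroˡ _))) (zeroʳ _))) ⟩
      sign j * 0#
        ≈⟨ zeroʳ _ ⟩
      0#
        ∎

    det-unitRows-≢ : ∀ {j k} (j≢k : j ≢ k) →
                     det-unitRows j k ≈ sign j * (sign (punchOut j≢k) * minor₂ j (punchOut j≢k))
    det-unitRows-≢ {j} {k} j≢k = trans (det-unitRows-expand j k) (*-congˡ (begin
      ∑[ m < suc n ] sign m * (δ k (punchIn j m) * minor₂ j m)
        ≈⟨ ∑-cong (suc n) (λ m → trans (*-congˡ (*-congʳ (δ-punchIn-punchOut j≢k m))) (*-swap (sign m) _ _)) ⟩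
      ∑[ m < suc n ] δ (punchOut j≢k) m * (sign m * minor₂ j m)
        ≈⟨ ∑-δ* (suc n) _ (punchOut j≢k) ⟩
      sign (punchOut j≢k) * minor₂ j (punchOut j≢k)
        ∎))

    det-unitRows-antisym : ∀ j k → det-unitRows j k ≈ - det-unitRows k j
    det-unitRows-antisym j k with j ≟ k
    ... | yes ≡.refl = trans (det-unitRows-refl j) (trans (sym -0#≈0#) (-‿cong (sym (det-unitRows-refl j))))
    ... | no j≢k = begin
      det-unitRows j k                   ≈⟨ det-unitRows-≢ j≢k ⟩
      sign j * (sign p * minor₂ j p)     ≈⟨ *-assoc _ _ _ ⟨
      (sign j * sign p) * minor₂ j p     ≈⟨ *-cong (sign-punchOut j≢k k≢j) (det-cong n (λ i l → reflexive
                                              (≡.cong (M (suc (suc i))) (punchIn-punchIn-punchOut j≢k k≢j l)))) ⟩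
      - (sign k * sign q) * minor₂ k q   ≈⟨ -‿distribˡ-* _ _ ⟨
      - ((sign k * sign q) * minor₂ k q) ≈⟨ -‿cong (*-assoc _ _ _) ⟩
      - (sign k * (sign q * minor₂ k q)) ≈⟨ -‿cong (det-unitRows-≢ k≢j) ⟨
      - det-unitRows k j                 ∎
      where
      k≢j = j≢k ∘ ≡.sym
      p = punchOut j≢k
      q = punchOut k≢j

    -- Expanding along rows 0 and 1 writes det M as the antisymmetric double sum
    -- Σⱼ Σₖ aⱼ aₖ (det-unitRows j k), where a is the common row.
    det-rows01-equal : (∀ j → M zero j ≈ M (suc zero) j) → det (suc (suc n)) M ≈ 0#
    det-rows01-equal e = begin
      det (suc (suc n)) M
        ≈⟨ det-expand (suc (suc n)) M zero ⟩
      ∑[ j < suc (suc n) ] a j * cofactor M zero j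
        ≈⟨ ∑-cong (suc (suc n)) (λ j → *-congˡ (trans (det-expand (suc (suc n)) (M [ zero ]≔ δ j) (suc zero))
                                                     (∑-cong (suc (suc n)) (λ k → *-congʳ (sym (e k)))))) ⟩
      ∑[ j < suc (suc n) ] a j * (∑[ k < suc (suc n) ] a k * det-unitRows j k)
        ≈⟨ ∑-cong (suc (suc n)) (λ j → *-distribˡ-∑ (suc (suc n)) (a j) _) ⟩
      ∑[ j < suc (suc n) ] ∑[ k < suc (suc n) ] G j k
        ≈⟨ ∑∑-antisym (suc (suc n)) G G-antisym G-refl ⟩
      0#
        ∎
      where
      a = M zero
      G : Fin (suc (suc n)) → Fin (suc (suc n)) → C
      G j k = a j * (a k * det-unitRows j k)
      G-antisym : ∀ j k → G j k ≈ - G k j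
      G-antisym j k = begin
        a j * (a k * det-unitRows j k)     ≈⟨ *-congˡ (*-congˡ (det-unitRows-antisym j k)) ⟩
        a j * (a k * - det-unitRows k j)   ≈⟨ *-swap _ _ _ ⟩
        a k * (a j * - det-unitRows k j)   ≈⟨ *-congˡ (-‿distribʳ-* _ _) ⟨
        a k * - (a j * det-unitRows k j)   ≈⟨ -‿distribʳ-* _ _ ⟨
        - (a k * (a j * det-unitRows k j)) ∎
      G-refl : ∀ j → G j j ≈ 0#
      G-refl j = trans (*-congˡ (trans (*-congˡ (det-unitRows-refl j)) (zeroʳ _))) (zeroʳ _)

  open FirstTwoRows using (det-rows01-equal)

  EqualRowsVanish : ∀ n → Fin n → Fin n → Set ℓ
  EqualRowsVanish n r s = ∀ (M : Matrix C n) → (∀ j → M r j ≈ M s j) → det n M ≈ 0#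

  det-equalRows-suc : ∀ n {r s} → EqualRowsVanish n r s → EqualRowsVanish (suc n) (suc r) (suc s)
  det-equalRows-suc n vanish M e = trans (det-suc n M) (∑-zero (suc n) (λ j →
    trans (*-congˡ (trans (*-congˡ (vanish (minor j M) (λ l → e (punchIn j l)))) (zeroʳ _))) (zeroʳ _)))

  -- Expanding F (v + w) (v + w) = 0 by bilinearity leaves F v w + F w v = 0.
  det-swapRows : ∀ n {p q} → p ≢ q → EqualRowsVanish n p q → ∀ M v w →
                 det n (M [ p ]≔ v [ q ]≔ w) ≈ - det n (M [ p ]≔ w [ q ]≔ v)
  det-swapRows n {p} {q} p≢q vanish M v w = inverseˡ-unique (F v w) (F w v) (begin
    F v w + F w v                              ≈⟨ +-cong (+-identityˡ _) (+-identityʳ _) ⟨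
    (0# + F v w) + (F w v + 0#)                ≈⟨ +-cong (+-congʳ (diag v)) (+-congˡ (diag w)) ⟨
    (F v v + F v w) + (F w v + F w w)          ≈⟨ +-cong (linearʳ v v w) (linearʳ w v w) ⟨
    F v (λ k → v k + w k) + F w (λ k → v k + w k) ≈⟨ linearˡ v w _ ⟨
    F (λ k → v k + w k) (λ k → v k + w k)      ≈⟨ diag _ ⟩
    0#                                         ∎)
    where
    F : (Fin n → C) → (Fin n → C) → C
    F x y = det n (M [ p ]≔ x [ q ]≔ y)
    diag : ∀ x → F x x ≈ 0#
    diag x = vanish (M [ p ]≔ x [ q ]≔ x) (λ j → reflexive (≡.cong (_$ j) (≡.trans
      (≡.trans (updateAt-minimal p q (M [ p ]≔ x) p≢q) (updateAt-updates p M))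
      (≡.sym (updateAt-updates q (M [ p ]≔ x))))))
    linearʳ : ∀ x y z → F x (λ k → y k + z k) ≈ F x y + F x z
    linearʳ x = det-[]≔-+ n (M [ p ]≔ x) q
    swap : ∀ x y → F x y ≈ det n (M [ q ]≔ y [ p ]≔ x)
    swap x y = det-cong-≗ n (updateAt-commutes q p (p≢q ∘ ≡.sym) M)
    linearˡ : ∀ x y z → F (λ k → x k + y k) z ≈ F x z + F y z
    linearˡ x y z = trans (swap _ z) (trans (det-[]≔-+ n (M [ q ]≔ z) p x y)
                                            (sym (+-cong (swap x z) (swap y z))))

  det-equalRows₀ : ∀ n s → EqualRowsVanish (suc n) zero (suc s)
  det-equalRows₀ (suc n) zero    = det-rows01-equal
  -- Swapping rows 1 and s + 2 reduces this to equal rows 0 and 1.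
  det-equalRows₀ (suc n) (suc s) M e = begin
    det (suc (suc n)) M
      ≈⟨ det-cong-≗ (suc (suc n)) (λ i → ≡.trans (updateAt-id-local (suc (suc s)) (M [ suc zero ]≔ v) ≡.refl i)
                                                  (updateAt-id-local (suc zero) M ≡.refl i)) ⟨
    det (suc (suc n)) (M [ suc zero ]≔ v [ suc (suc s) ]≔ w)
      ≈⟨ det-swapRows (suc (suc n)) (λ ()) (det-equalRows-suc (suc n) (det-equalRows₀ n s)) M v w ⟩
    - det (suc (suc n)) (M [ suc zero ]≔ w [ suc (suc s) ]≔ v)
      ≈⟨ -‿cong (det-rows01-equal (M [ suc zero ]≔ w [ suc (suc s) ]≔ v) e) ⟩
    - 0#
      ≈⟨ -0#≈0# ⟩
    0#
      ∎
    where
    v = M (suc zero)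
    w = M (suc (suc s))

  det-equalRows : ∀ n {r s} → r ≢ s → EqualRowsVanish n r s
  det-equalRows (suc n) {zero}  {zero}  r≢s = contradiction ≡.refl r≢s
  det-equalRows (suc n) {zero}  {suc s} _   = det-equalRows₀ n s
  det-equalRows (suc n) {suc r} {zero}  _   M e = det-equalRows₀ n r M (λ j → sym (e j))
  det-equalRows (suc n) {suc r} {suc s} r≢s = det-equalRows-suc n (det-equalRows n (r≢s ∘ ≡.cong suc))

  ∑-*cofactor : ∀ n (M : Matrix C n) r c → ∑[ k < n ] M c k * cofactor M r k ≈ δ r c * det n M
  ∑-*cofactor n M r c with r ≟ c
  ... | yes ≡.refl = trans (sym (det-expand n M r)) (sym (trans (*-congʳ (δ-refl r)) (*-identityˡ _)))
  ... | no r≢c = begin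
    ∑[ k < n ] M c k * cofactor M r k     ≈⟨ det-expandRow n M r (M c) ⟨
    det n (M [ r ]≔ M c)                  ≈⟨ det-equalRows n r≢c (M [ r ]≔ M c) rows-r-c ⟩
    0#                                    ≈⟨ trans (*-congʳ (δ-≢ r≢c)) (zeroˡ _) ⟨
    δ r c * det n M                       ∎
    where
    rows-r-c : ∀ j → (M [ r ]≔ M c) r j ≈ (M [ r ]≔ M c) c j
    rows-r-c j = reflexive (≡.cong (_$ j)
      (≡.trans (updateAt-updates r M) (≡.sym (updateAt-minimal c r M (r≢c ∘ ≡.sym)))))

  -- adj(M) M = det M · I and the symmetry of M give adj(M) · det M = adj(M)ᵀ · det M.
  cofactor-sym-*det : ∀ n (M : Matrix C n) → (∀ i j → M i j ≈ M j i) →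
                      ∀ a c → cofactor M c a * det n M ≈ cofactor M a c * det n M
  cofactor-sym-*det n M M-sym a c = begin
    cofactor M c a * d                                                ≈⟨ ∑-*δ* (cofactor M c) a ⟨
    ∑[ j < n ] cofactor M c j * (δ a j * d)                           ≈⟨ ∑-cong n (λ j → *-congˡ (adj a j)) ⟨
    ∑[ j < n ] cofactor M c j * (∑[ k < n ] M j k * cofactor M a k)   ≈⟨ ∑-cong n (λ j → *-distribˡ-∑ n _ _) ⟩
    ∑[ j < n ] ∑[ k < n ] cofactor M c j * (M j k * cofactor M a k)   ≈⟨ ∑-comm n n _ ⟩
    ∑[ k < n ] ∑[ j < n ] cofactor M c j * (M j k * cofactor M a k)   ≈⟨ ∑-cong n (λ k → ∑-cong n (reorder k)) ⟩
    ∑[ k < n ] ∑[ j < n ] cofactor M a k * (M k j * cofactor M c j)   ≈⟨ ∑-cong n (λ k → *-distribˡ-∑ n _ _) ⟨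
    ∑[ k < n ] cofactor M a k * (∑[ j < n ] M k j * cofactor M c j)   ≈⟨ ∑-cong n (λ k → *-congˡ (adj c k)) ⟩
    ∑[ k < n ] cofactor M a k * (δ c k * d)                           ≈⟨ ∑-*δ* (cofactor M a) c ⟩
    cofactor M a c * d                                                ∎
    where
    d = det n M
    adj = ∑-*cofactor n M
    ∑-*δ* : ∀ f b → ∑[ j < n ] f j * (δ b j * d) ≈ f b * d
    ∑-*δ* f b = begin
      ∑[ j < n ] f j * (δ b j * d)   ≈⟨ ∑-cong n (λ j → trans (sym (*-assoc _ _ _)) (*-congʳ (*-congˡ (δ-sym b j)))) ⟩
      ∑[ j < n ] (f j * δ j b) * d   ≈⟨ *-distribʳ-∑ n d _ ⟨
      (∑[ j < n ] f j * δ j b) * d   ≈⟨ *-congʳ (∑-*δ n f b) ⟩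
      f b * d                        ∎
    reorder : ∀ k j → cofactor M c j * (M j k * cofactor M a k) ≈ cofactor M a k * (M k j * cofactor M c j)
    reorder k j = begin
      cofactor M c j * (M j k * cofactor M a k)  ≈⟨ *-congˡ (*-comm _ _) ⟩
      cofactor M c j * (cofactor M a k * M j k)  ≈⟨ *-swap _ _ _ ⟩
      cofactor M a k * (cofactor M c j * M j k)  ≈⟨ *-congˡ (trans (*-comm _ _) (*-congʳ (M-sym j k))) ⟩
      cofactor M a k * (M k j * cofactor M c j)  ∎

  -- det (M − 𝟙 uᵀ): by multilinearity in the rows, only the terms with at most one row u survive.
  det-subtractRow : ∀ n (M : Matrix C n) u →
                    det n (λ i j → M i j - u j) ≈ det n M - (∑[ c < n ] det n (M [ c ]≔ u))
  det-[0]≔-subtractRow : ∀ n (M : Matrix C (suc n)) u w →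
                         det (suc n) ((λ i j → M i j - u j) [ zero ]≔ w)
                         ≈ det (suc n) (M [ zero ]≔ w) - (∑[ c < n ] det (suc n) (M [ zero ]≔ w [ suc c ]≔ u))

  det-subtractRow zero    M u = sym (trans (+-congˡ (trans (-‿cong (∑-zero zero (λ ()))) -0#≈0#)) (+-identityʳ _))
  det-subtractRow (suc n) M u = begin
    det (suc n) N
      ≈⟨ det-cong-≗ (suc n) (updateAt-id-local zero {const (N zero)} N ≡.refl) ⟨
    det (suc n) (N [ zero ]≔ (λ k → M zero k - u k))
      ≈⟨ det-[]≔-+ (suc n) N zero (M zero) (λ k → - u k) ⟩
    det (suc n) (N [ zero ]≔ M zero) + det (suc n) (N [ zero ]≔ (λ k → - u k))
      ≈⟨ +-cong (det-[0]≔-subtractRow n M u (M zero)) (det-[]≔-neg (suc n) N zero u) ⟩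
    (det (suc n) (M [ zero ]≔ M zero) - S) - det (suc n) (N [ zero ]≔ u)
      ≈⟨ +-cong (+-congʳ (det-cong-≗ (suc n) (updateAt-id-local zero {const (M zero)} M ≡.refl)))
                (-‿cong (trans (det-[0]≔-subtractRow n M u u) (trans (+-congˡ (-‿cong (∑-zero n twoRowsU)))
                                                                     (trans (+-congˡ -0#≈0#) (+-identityʳ _))))) ⟩
    (det (suc n) M - S) - det (suc n) (M [ zero ]≔ u)
      ≈⟨ +-assoc _ _ _ ⟩
    det (suc n) M + (- S - det (suc n) (M [ zero ]≔ u))
      ≈⟨ +-congˡ (trans (-‿cong (∑-suc n _)) (-‿anti-homo-+ _ _)) ⟨
    det (suc n) M - (∑[ c < suc n ] det (suc n) (M [ c ]≔ u))
      ∎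
    where
    N = λ i j → M i j - u j
    S = ∑[ c < n ] det (suc n) (M [ suc c ]≔ u)
    twoRowsU : ∀ c → det (suc n) (M [ zero ]≔ u [ suc c ]≔ u) ≈ 0#
    twoRowsU c = det-equalRows (suc n) {zero} {suc c} (λ ()) (M [ zero ]≔ u [ suc c ]≔ u)
                   (λ j → reflexive (≡.cong (_$ j) (≡.sym (updateAt-updates (suc c) (M [ zero ]≔ u)))))

  det-[0]≔-subtractRow n M u w = begin
    det (suc n) (N [ zero ]≔ w)
      ≈⟨ det-suc n (N [ zero ]≔ w) ⟩
    ∑[ j < suc n ] sign j * (w j * det n (λ i l → minor j M i l - u (punchIn j l)))
      ≈⟨ ∑-cong (suc n) (λ j → *-congˡ (*-congˡ (det-subtractRow n (minor j M) (u ∘ punchIn j)))) ⟩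
    ∑[ j < suc n ] sign j * (w j * (D j - (∑[ c < n ] E j c)))
      ≈⟨ ∑-cong (suc n) (λ j → distrib-- (sign j) (w j) (D j) _) ⟩
    ∑[ j < suc n ] sign j * (w j * D j) - sign j * (w j * (∑[ c < n ] E j c))
      ≈⟨ trans (∑-+ (suc n) _ _) (+-congˡ (∑-neg (suc n) _)) ⟩
    (∑[ j < suc n ] sign j * (w j * D j)) - (∑[ j < suc n ] sign j * (w j * (∑[ c < n ] E j c)))
      ≈⟨ +-cong (sym (det-suc n (M [ zero ]≔ w))) (-‿cong replaced) ⟩
    det (suc n) (M [ zero ]≔ w) - (∑[ c < n ] det (suc n) (M [ zero ]≔ w [ suc c ]≔ u))
      ∎
    where
    N = λ i j → M i j - u j
    D : Fin (suc n) → C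
    D j = det n (minor j M)
    E : Fin (suc n) → Fin n → C
    E j c = det n (minor j M [ c ]≔ u ∘ punchIn j)
    replaced : ∑[ j < suc n ] sign j * (w j * (∑[ c < n ] E j c))
               ≈ ∑[ c < n ] det (suc n) (M [ zero ]≔ w [ suc c ]≔ u)
    replaced = begin
      ∑[ j < suc n ] sign j * (w j * (∑[ c < n ] E j c))
        ≈⟨ ∑-cong (suc n) (λ j → trans (*-congˡ (*-distribˡ-∑ n _ _)) (*-distribˡ-∑ n _ _)) ⟩
      ∑[ j < suc n ] ∑[ c < n ] sign j * (w j * E j c)
        ≈⟨ ∑-comm (suc n) n _ ⟩
      ∑[ c < n ] ∑[ j < suc n ] sign j * (w j * E j c)
        ≈⟨ ∑-cong n (λ c → trans (∑-cong (suc n) (λ j → *-congˡ (*-congˡ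
             (sym (det-cong-≗ n (minor-[]≔ (M [ zero ]≔ w) c u j))))))
             (sym (det-suc n (M [ zero ]≔ w [ suc c ]≔ u)))) ⟩
      ∑[ c < n ] det (suc n) (M [ zero ]≔ w [ suc c ]≔ u)
        ∎
    distrib-- : ∀ a b x y → a * (b * (x - y)) ≈ a * (b * x) - a * (b * y)
    distrib-- a b x y = begin
      a * (b * (x - y))           ≈⟨ *-congˡ (distribˡ b x (- y)) ⟩
      a * (b * x + b * - y)       ≈⟨ distribˡ a _ _ ⟩
      a * (b * x) + a * (b * - y) ≈⟨ +-congˡ (trans (*-congˡ (sym (-‿distribʳ-* b y))) (sym (-‿distribʳ-* a _))) ⟩
      a * (b * x) - a * (b * y)   ∎

module TwoAdicLevel where

  open Polynomial
  open import Data.Nat using (_∸_; _^_; _≤_; _<_; pred; z≤n; s≤s)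
  import Data.Nat.Properties as ℕ
  open import Data.Integer using (ℤ; +_; 0ℤ; 1ℤ; -_) renaming (_+_ to _+ℤ_; _*_ to _*ℤ_)
  import Data.Integer.Properties as ℤ
  open import Data.Integer.Divisibility.Signed
    using (_∣_; divides; ∣-trans; ∣m∣n⇒∣m+n; ∣m⇒∣-m; *-monoʳ-∣; *-monoˡ-∣)
  open import Data.Integer.Tactic.RingSolver using (solve-∀)
  open ≡ using (refl; sym; trans; cong; subst; subst₂)

  2^_ : ℕ → ℤ
  2^ m = + (2 ^ m)

  2^-+ : ∀ a b → 2^ (a ℕ.+ b) ≡ 2^ a *ℤ 2^ b
  2^-+ a b = trans (cong +_ (ℕ.^-distribˡ-+-* 2 a b)) (ℤ.pos-* (2 ^ a) (2 ^ b))

  2^-mono-∣ : ∀ {a b} → a ≤ b → 2^ a ∣ 2^ b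
  2^-mono-∣ {a} {b} a≤b = divides (2^ (b ∸ a)) (trans (cong 2^_ (sym (ℕ.m∸n+n≡m a≤b))) (2^-+ (b ∸ a) a))

  ∣0 : ∀ k → k ∣ 0ℤ
  ∣0 k = divides 0ℤ (sym (ℤ.*-zeroˡ k))

  *-pres-∣ : ∀ {k l x y} → k ∣ x → l ∣ y → k *ℤ l ∣ x *ℤ y
  *-pres-∣ {k} {l} {x} {y} k∣x l∣y = ∣-trans (*-monoˡ-∣ l k∣x) (*-monoʳ-∣ x l∣y)

  -- Level m p says that 2^m divides p(2y) in ℤ[y].
  record Level (m : ℕ) (p : Poly) : Set where
    constructor level
    field divides-coeff : ∀ j → 2^ (m ∸ j) ∣ coeff p j
  open Level public

  Level-cong : ∀ {m p q} → p ≈ₚ q → Level m p → Level m q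
  Level-cong {m} p≈q lp = level λ j → subst (2^ (m ∸ j) ∣_) (at p≈q j) (divides-coeff lp j)

  Level-zero : ∀ p → Level 0 p
  Level-zero p = level λ j →
    subst (_∣ coeff p j) (cong 2^_ (sym (ℕ.0∸n≡0 j))) (divides (coeff p j) (sym (ℤ.*-identityʳ _)))

  Level-0ₚ : ∀ m → Level m 0ₚ
  Level-0ₚ m = level λ j → ∣0 _

  Level-mono : ∀ {m m′ p} → m′ ≤ m → Level m p → Level m′ p
  Level-mono m′≤m lp = level λ j → ∣-trans (2^-mono-∣ (ℕ.∸-monoˡ-≤ j m′≤m)) (divides-coeff lp j)

  Level-+ₚ : ∀ {m p q} → Level m p → Level m q → Level m (p +ₚ q)
  Level-+ₚ {m} {p} {q} lp lq = level λ j →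
    subst (2^ (m ∸ j) ∣_) (sym (coeff-+ₚ p q j)) (∣m∣n⇒∣m+n (divides-coeff lp j) (divides-coeff lq j))

  Level--ₚ : ∀ {m p} → Level m p → Level m (-ₚ p)
  Level--ₚ {m} {p} lp = level λ j → subst (2^ (m ∸ j) ∣_) (sym (coeff--ₚ p j)) (∣m⇒∣-m (divides-coeff lp j))

  m+n∸o≤m+[n∸o] : ∀ m n o → m ℕ.+ n ∸ o ≤ m ℕ.+ (n ∸ o)
  m+n∸o≤m+[n∸o] m zero    o       rewrite ℕ.0∸n≡0 o = ℕ.m∸n≤m (m ℕ.+ 0) o
  m+n∸o≤m+[n∸o] m (suc n) zero    = ℕ.≤-refl
  m+n∸o≤m+[n∸o] m (suc n) (suc o) rewrite ℕ.+-suc m n = m+n∸o≤m+[n∸o] m n o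

  m∸suc[n]≡pred[m]∸n : ∀ m n → m ∸ suc n ≡ pred m ∸ n
  m∸suc[n]≡pred[m]∸n zero    n = sym (ℕ.0∸n≡0 n)
  m∸suc[n]≡pred[m]∸n (suc m) n = refl

  pred[m+n]≤pred[m]+n : ∀ m n → pred (m ℕ.+ n) ≤ pred m ℕ.+ n
  pred[m+n]≤pred[m]+n zero    n = ℕ.pred[n]≤n
  pred[m+n]≤pred[m]+n (suc m) n = ℕ.≤-refl

  Level-scaleₚ : ∀ {a b} c {q} → 2^ a ∣ c → Level b q → Level (a ℕ.+ b) (scaleₚ c q)
  Level-scaleₚ {a} {b} c {q} 2^a∣c lq = level λ j → subst (2^ (a ℕ.+ b ∸ j) ∣_) (sym (coeff-scaleₚ c q j))
    (∣-trans (2^-mono-∣ (m+n∸o≤m+[n∸o] a b j))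
             (subst (_∣ c *ℤ coeff q j) (sym (2^-+ a (b ∸ j))) (*-pres-∣ 2^a∣c (divides-coeff lq j))))

  Level-linear : ∀ {a} b → + 2 ∣ a → Level 1 (a ∷ b ∷ [])
  Level-linear b 2∣a = level λ
    { zero          → 2∣a
    ; (suc zero)    → divides b (sym (ℤ.*-identityʳ b))
    ; (suc (suc j)) → ∣0 _
    }

  Level-tail : ∀ {a c p} → Level a (c ∷ p) → Level (pred a) p
  Level-tail {a} {c} {p} lp = level λ j →
    subst (λ e → 2^ e ∣ coeff p j) (m∸suc[n]≡pred[m]∸n a j) (divides-coeff lp (suc j))

  Level-0∷ : ∀ {m p} → Level (pred m) p → Level m (0ℤ ∷ p)
  Level-0∷ {m} {p} lp = level λ
    { zero    → ∣0 _
    ; (suc j) → subst (λ e → 2^ e ∣ coeff p j) (sym (m∸suc[n]≡pred[m]∸n m j)) (divides-coeff lp j)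
    }

  Level-*ₚ : ∀ {a b} p q → Level a p → Level b q → Level (a ℕ.+ b) (p *ₚ q)
  Level-*ₚ {a} {b} []      q lp lq = Level-0ₚ (a ℕ.+ b)
  Level-*ₚ {a} {b} (c ∷ p) q lp lq = Level-+ₚ (Level-scaleₚ c (divides-coeff lp zero) lq)
    (Level-0∷ (Level-mono (pred[m+n]≤pred[m]+n a b) (Level-*ₚ p q (Level-tail lp) lq)))

  Level-+ₚ-self : ∀ {m p} → Level m p → Level (suc m) (p +ₚ p)
  Level-+ₚ-self {m} {p} lp = level λ j → subst (2^ (suc m ∸ j) ∣_) (sym (coeff-+ₚ p p j))
    (∣-trans (2^-mono-∣ (m+n∸o≤m+[n∸o] 1 m j))
             (subst (_∣ coeff p j +ℤ coeff p j) (sym (2^-+ 1 (m ∸ j))) (double (divides-coeff lp j))))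
    where
    double : ∀ {k x} → k ∣ x → + 2 *ℤ k ∣ x +ℤ x
    double {k} (divides q x≡qk) = divides q (trans (cong (λ z → z +ℤ z) x≡qk) (reassoc q k))
      where
      reassoc : ∀ q k → q *ℤ k +ℤ q *ℤ k ≡ q *ℤ (+ 2 *ℤ k)
      reassoc = solve-∀

  -- The even factor j + 1 in coeff (∂ p) j = (j + 1) pⱼ₊₁ makes up for the shifted index.
  Level-∂ : ∀ {m p} j → j < m → + 2 ∣ + suc j → Level m p → 2^ (m ∸ j) ∣ coeff (∂ p) j
  Level-∂ {m} {p} j j<m 2∣1+j lp = subst₂ _∣_
    (trans (sym (2^-+ 1 (m ∸ suc j))) (cong 2^_ (sym (ℕ.+-∸-assoc 1 j<m))))
    (sym (coeff-∂ p j))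
    (*-pres-∣ 2∣1+j (divides-coeff lp (suc j)))

module PolynomialMatrix where

  open Polynomial
  open TwoAdicLevel
  open Determinant ring
    using (det; altSum; minor; sign; _[_]≔_; minor-[]≔; det-suc; det-cong-≗;
           ∑; ∑-suc; ∑-zero; ∑-cong; ∑-+; ∑-comm; *-distribˡ-∑; ∑<)
  open import Data.Vec.Functional using (updateAt)
  open import Data.Nat using (_<_; z≤n; s≤s)
  open import Data.Integer using (ℤ; +_; 0ℤ; 1ℤ; -_) renaming (_+_ to _+ℤ_; _*_ to _*ℤ_)
  import Data.Integer.Properties as ℤ
  open import Data.List using (tabulate)
  open import Data.Nat.Properties using (+-*-semiring)
  import Algebra.Properties.Semiring.Sum +-*-semiring as ℕΣ
  open import Function using (_∘_)
  open ≡ using (refl; sym; trans; cong; cong₂; subst)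

  module ℤDet = Determinant ℤ.+-*-commutativeRing

  Level-∑ : ∀ {m} n (f : Fin n → Poly) → (∀ j → Level m (f j)) → Level m (∑ n f)
  Level-∑ {m} zero    f lf = Level-cong (≈ₚ-sym (∑-zero zero (λ ()))) (Level-0ₚ m)
  Level-∑ {m} (suc n) f lf =
    Level-cong (≈ₚ-sym (∑-suc n f)) (Level-+ₚ (lf zero) (Level-∑ n (f ∘ suc) (lf ∘ suc)))

  Level-∑< : ∀ {m} n (G : Fin n → Fin n → Poly) → (∀ j k → Level m (G j k)) → Level m (∑< n G)
  Level-∑< {m} zero    G lG = Level-0ₚ m
  Level-∑< {m} (suc n) G lG = Level-+ₚ (Level-∑ n _ (lG zero ∘ suc))
                                       (Level-∑< n _ (λ j k → lG (suc j) (suc k)))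

  Level-altSum : ∀ {m} n (f : Fin n → Poly) → (∀ j → Level m (f j)) → Level m (altSum (tabulate f))
  Level-altSum {m} zero    f lf = Level-0ₚ m
  Level-altSum {m} (suc n) f lf = Level-+ₚ (lf zero) (Level--ₚ (Level-altSum n (f ∘ suc) (lf ∘ suc)))

  Level-det : ∀ n (ℓ : Fin n → ℕ) (M : Matrix Poly n) → (∀ i j → Level (ℓ i) (M i j)) →
              Level (ℕΣ.sum ℓ) (det n M)
  Level-det zero    ℓ M lM = Level-zero 1ₚ
  Level-det (suc n) ℓ M lM = Level-altSum (suc n) (λ j → M zero j *ₚ det n (minor j M)) (λ j →
    Level-*ₚ (M zero j) (det n (minor j M)) (lM zero j)
             (Level-det n (ℓ ∘ suc) (minor j M) (λ i l → lM (suc i) (punchIn j l))))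

  sum-ones : ∀ n → ℕΣ.sum {n} (λ _ → 1) ≡ n
  sum-ones zero    = refl
  sum-ones (suc n) = cong suc (sum-ones n)

  sum-ones-except : ∀ {n} (r : Fin (suc n)) → ℕΣ.sum (updateAt (λ _ → 1) r (λ _ → 0)) ≡ n
  sum-ones-except {n}     zero    = sum-ones n
  sum-ones-except {suc n} (suc r) = cong suc (sum-ones-except r)

  -- Row r drops to level 0, so the levels of the rows now sum to n.
  Level-det-[]≔ : ∀ n (M : Matrix Poly (suc n)) r v → (∀ i j → Level 1 (M i j)) →
                  Level n (det (suc n) (M [ r ]≔ v))
  Level-det-[]≔ n M r v lM = subst (λ l → Level l (det (suc n) (M [ r ]≔ v))) (sum-ones-except r)
    (Level-det (suc n) (updateAt (λ _ → 1) r (λ _ → 0)) (M [ r ]≔ v) (rows M r lM))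
    where
    rows : ∀ {k} (N : Fin k → Fin (suc n) → Poly) r → (∀ i j → Level 1 (N i j)) →
           ∀ i j → Level (updateAt (λ _ → 1) r (λ _ → 0) i) (updateAt N r (λ _ → v) i j)
    rows N zero    lN zero    j = Level-zero (v j)
    rows N zero    lN (suc i) j = lN (suc i) j
    rows N (suc r) lN zero    j = lN zero j
    rows N (suc r) lN (suc i) j = rows (N ∘ suc) r (lN ∘ suc) i j

  degree-altSum : ∀ {a} n (f : Fin n → Poly) → (∀ j → DegreeAtMost a (f j)) → DegreeAtMost a (altSum (tabulate f))
  degree-altSum zero    f df = degree≤ λ j a<j → refl
  degree-altSum (suc n) f df = degree-+ₚ (df zero) (degree--ₚ (degree-altSum n (f ∘ suc) (df ∘ suc)))

  coeff-altSum : ∀ n (f : Fin n → Poly) t →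
                 coeff (altSum (tabulate f)) t ≡ ℤDet.altSum (tabulate (λ j → coeff (f j) t))
  coeff-altSum zero    f t = refl
  coeff-altSum (suc n) f t = begin
    coeff (f zero +ₚ (-ₚ rest)) t         ≡⟨ coeff-+ₚ (f zero) (-ₚ rest) t ⟩
    coeff (f zero) t +ℤ coeff (-ₚ rest) t ≡⟨ cong (coeff (f zero) t +ℤ_) (coeff--ₚ rest t) ⟩
    coeff (f zero) t +ℤ - coeff rest t    ≡⟨ cong (λ x → coeff (f zero) t +ℤ - x) (coeff-altSum n (f ∘ suc) t) ⟩
    ℤDet.altSum (tabulate (λ j → coeff (f j) t)) ∎
    where
    open ≡.≡-Reasoning
    rest = altSum (tabulate (f ∘ suc))

  degree-det : ∀ n (M : Matrix Poly n) → (∀ i j → DegreeAtMost 1 (M i j)) → DegreeAtMost n (det n M)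
  degree-det zero    M dM = degree≤ λ { (suc j) _ → refl }
  degree-det (suc n) M dM = degree-altSum (suc n) (λ j → M zero j *ₚ det n (minor j M)) (λ j →
    degree-*ₚ (M zero j) (det n (minor j M)) (dM zero j) (degree-det n (minor j M) (λ i l → dM (suc i) (punchIn j l))))

  coeff-det-top : ∀ n (M : Matrix Poly n) → (∀ i j → DegreeAtMost 1 (M i j)) →
                  coeff (det n M) n ≡ ℤDet.det n (λ i j → coeff (M i j) 1)
  coeff-det-top zero    M dM = refl
  coeff-det-top (suc n) M dM = trans (coeff-altSum (suc n) (λ j → M zero j *ₚ det n (minor j M)) (suc n))
    (ℤDet.altSum-cong (suc n) (λ j →
    trans (coeff-*ₚ-top 1 n (M zero j) (det n (minor j M)) (dM zero j) (degree-det n (minor j M) dMinor))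
          (cong (coeff (M zero j) 1 *ℤ_) (coeff-det-top n (minor j M) dMinor))))
    where
    dMinor : ∀ {j} i l → DegreeAtMost 1 (minor j M i l)
    dMinor {j} i l = dM (suc i) (punchIn j l)

  ∂-∑ : ∀ n (f : Fin n → Poly) → ∂ (∑ n f) ≈ₚ ∑[ j < n ] ∂ (f j)
  ∂-∑ zero    f = ≈ₚ-trans (∂-cong (∑-zero zero (λ ()))) (≈ₚ-sym (∑-zero zero (λ ())))
  ∂-∑ (suc n) f = begin
    ∂ (∑ (suc n) f)                      ≈⟨ ∂-cong (∑-suc n f) ⟩
    ∂ (f zero +ₚ ∑ n (f ∘ suc))          ≈⟨ ∂-+ₚ (f zero) _ ⟩
    ∂ (f zero) +ₚ ∂ (∑ n (f ∘ suc))      ≈⟨ +ₚ-congˡ (∂ (f zero)) (∂-∑ n (f ∘ suc)) ⟩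
    ∂ (f zero) +ₚ (∑[ j < n ] ∂ (f (suc j))) ≈⟨ ∑-suc n (∂ ∘ f) ⟨
    ∑[ j < suc n ] ∂ (f j)               ∎
    where open ≈ₚ-Reasoning

  ∂-sign : ∀ {n} (j : Fin n) → ∂ (sign j) ≈ₚ 0ₚ
  ∂-sign zero    = ≈ₚ-refl
  ∂-sign (suc j) = ≈ₚ-trans (∂-scaleₚ (- 1ℤ) (sign j)) (scaleₚ-cong (- 1ℤ) (∂-sign j))

  ∂-sign-*ₚ : ∀ {n} (j : Fin n) p → ∂ (sign j *ₚ p) ≈ₚ sign j *ₚ ∂ p
  ∂-sign-*ₚ j p = ≈ₚ-trans (∂-*ₚ (sign j) p) (+ₚ-congʳ (sign j *ₚ ∂ p) (*ₚ-congˡ p (∂-sign j)))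

  ∂-det : ∀ n (M : Matrix Poly n) → ∂ (det n M) ≈ₚ ∑[ r < n ] det n (M [ r ]≔ ∂ ∘ M r)
  ∂-det zero    M = ≈ₚ-sym (∑-zero zero (λ ()))
  ∂-det (suc n) M = begin
    ∂ (det (suc n) M)
      ≈⟨ ∂-cong (det-suc n M) ⟩
    ∂ (∑[ j < suc n ] sign j *ₚ (M zero j *ₚ D j))
      ≈⟨ ∂-∑ (suc n) _ ⟩
    ∑[ j < suc n ] ∂ (sign j *ₚ (M zero j *ₚ D j))
      ≈⟨ ∑-cong (suc n) (λ j → ≈ₚ-trans (∂-sign-*ₚ j _) (*ₚ-congʳ (sign j) (∂-*ₚ (M zero j) (D j)))) ⟩
    ∑[ j < suc n ] sign j *ₚ ((∂ (M zero j) *ₚ D j) +ₚ (M zero j *ₚ ∂ (D j)))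
      ≈⟨ ∑-cong (suc n) (λ j → *ₚ-distribˡ (sign j) _ _) ⟩
    ∑[ j < suc n ] (sign j *ₚ (∂ (M zero j) *ₚ D j)) +ₚ (sign j *ₚ (M zero j *ₚ ∂ (D j)))
      ≈⟨ ∑-+ (suc n) _ _ ⟩
    (∑[ j < suc n ] sign j *ₚ (∂ (M zero j) *ₚ D j)) +ₚ (∑[ j < suc n ] sign j *ₚ (M zero j *ₚ ∂ (D j)))
      ≈⟨ +ₚ-cong (≈ₚ-sym (det-suc n (M [ zero ]≔ ∂ ∘ M zero))) minors ⟩
    det (suc n) (M [ zero ]≔ ∂ ∘ M zero) +ₚ (∑[ r < n ] det (suc n) (M [ suc r ]≔ ∂ ∘ M (suc r)))
      ≈⟨ ∑-suc n _ ⟨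
    ∑[ r < suc n ] det (suc n) (M [ r ]≔ ∂ ∘ M r)
      ∎
    where
    open ≈ₚ-Reasoning
    D : Fin (suc n) → Poly
    D j = det n (minor j M)
    E : Fin (suc n) → Fin n → Poly
    E j r = det n (minor j M [ r ]≔ ∂ ∘ minor j M r)
    minors : ∑[ j < suc n ] sign j *ₚ (M zero j *ₚ ∂ (D j))
             ≈ₚ ∑[ r < n ] det (suc n) (M [ suc r ]≔ ∂ ∘ M (suc r))
    minors = begin
      ∑[ j < suc n ] sign j *ₚ (M zero j *ₚ ∂ (D j))
        ≈⟨ ∑-cong (suc n) (λ j → *ₚ-congʳ (sign j) (*ₚ-congʳ (M zero j) (∂-det n (minor j M)))) ⟩
      ∑[ j < suc n ] sign j *ₚ (M zero j *ₚ (∑[ r < n ] E j r))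
        ≈⟨ ∑-cong (suc n) (λ j → ≈ₚ-trans (*ₚ-congʳ (sign j) (*-distribˡ-∑ n (M zero j) _))
                                          (*-distribˡ-∑ n (sign j) _)) ⟩
      ∑[ j < suc n ] ∑[ r < n ] sign j *ₚ (M zero j *ₚ E j r)
        ≈⟨ ∑-comm (suc n) n _ ⟩
      ∑[ r < n ] ∑[ j < suc n ] sign j *ₚ (M zero j *ₚ E j r)
        ≈⟨ ∑-cong n (λ r → ≈ₚ-trans
             (∑-cong (suc n) (λ j → *ₚ-congʳ (sign j) (*ₚ-congʳ (M zero j)
               (≈ₚ-sym (det-cong-≗ n (minor-[]≔ M r (∂ ∘ M (suc r)) j))))))
             (≈ₚ-sym (det-suc n (M [ suc r ]≔ ∂ ∘ M (suc r))))) ⟩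
      ∑[ r < n ] det (suc n) (M [ suc r ]≔ ∂ ∘ M (suc r))
        ∎

open import Data.Integer using (ℤ; +_; 0ℤ; 1ℤ; -_) renaming (_+_ to _+ℤ_; _*_ to _*ℤ_)
import Data.Integer.Properties as ℤ
open import Data.Sum using (_⊎_; inj₁; inj₂)

module SignMatrix (m : ℕ) (H : Matrix ℤ (suc m))
                  (H-sym : ∀ i j → H i j ≡ H j i)
                  (H-±1 : ∀ i j → H i j ≡ 1ℤ ⊎ H i j ≡ - 1ℤ) where

  open Polynomial
  open TwoAdicLevel
  open PolynomialMatrix
  open Determinant ring
    using (det; δ; cofactor; _[_]≔_; ∑; ∑-cong; ∑<; ∑∑-sym; det-cong; det-expandRow; det-[]≔-cong;
           cofactor-sym-*det; det-subtractRow)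
  open import Data.Nat using (_∸_; _<_; s≤s)
  open import Data.Integer.Divisibility.Signed using (_∣_; divides; ∣m∣n⇒∣m+n; ∣m⇒∣-m)
  open import Data.Fin using (_≟_)
  open import Relation.Nullary using (yes; no)
  open ≡ using (refl; sym; trans; cong; subst)

  xI-H-entry : ∀ i j → xI-H H i j ≈ₚ (- H i j) ∷ ℤDet.δ i j ∷ []
  xI-H-entry i j with i ≟ j
  ... | yes refl = ∷-cong refl (∷-cong (sym (ℤDet.δ-refl i)) ≈ₚ-refl)
  ... | no i≢j   = mk≈ λ { zero → refl ; (suc zero) → sym (ℤDet.δ-≢ i≢j) ; (suc (suc _)) → refl }

  A : Matrix Poly (suc m)
  A i j = xI-H H i j +ₚ 1ₚ

  A-entry : ∀ i j → A i j ≈ₚ (- H i j +ℤ 1ℤ) ∷ ℤDet.δ i j ∷ []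
  A-entry i j = +ₚ-congʳ 1ₚ (xI-H-entry i j)

  2∣1-H : ∀ i j → + 2 ∣ - H i j +ℤ 1ℤ
  2∣1-H i j with H-±1 i j
  ... | inj₁ Hᵢⱼ≡1  rewrite Hᵢⱼ≡1  = divides 0ℤ refl
  ... | inj₂ Hᵢⱼ≡-1 rewrite Hᵢⱼ≡-1 = divides 1ℤ refl

  Level-A : ∀ i j → Level 1 (A i j)
  Level-A i j = Level-cong (≈ₚ-sym (A-entry i j)) (Level-linear (ℤDet.δ i j) (2∣1-H i j))

  degree-A : ∀ i j → DegreeAtMost 1 (A i j)
  degree-A i j = degree-cong (≈ₚ-sym (A-entry i j))
                             (degree≤ λ { (suc (suc _)) _ → refl ; (suc zero) (s≤s ()) })

  δ-const : ∀ {n} (i j : Fin n) → δ i j ≈ₚ ℤDet.δ i j ∷ []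
  δ-const zero    zero    = ≈ₚ-refl
  δ-const zero    (suc j) = ≈ₚ-sym (0∷-≈0 ≈ₚ-refl)
  δ-const (suc i) zero    = ≈ₚ-sym (0∷-≈0 ≈ₚ-refl)
  δ-const (suc i) (suc j) = δ-const i j

  ∂-A : ∀ i j → ∂ (A i j) ≈ₚ δ i j
  ∂-A i j = ≈ₚ-trans (∂-cong (A-entry i j))
                     (≈ₚ-sym (≈ₚ-trans (δ-const i j) (∷-cong (sym (ℤ.*-identityˡ _)) ≈ₚ-refl)))

  A-sym : ∀ i j → A i j ≈ₚ A j i
  A-sym i j = ≈ₚ-trans (A-entry i j)
    (≈ₚ-trans (∷-cong (cong (λ h → - h +ℤ 1ℤ) (H-sym i j)) (∷-cong (ℤDet.δ-sym i j) ≈ₚ-refl))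
              (≈ₚ-sym (A-entry j i)))

  d : Poly
  d = det (suc m) A

  Level-d : Level (suc m) d
  Level-d = subst (λ l → Level l d) (sum-ones (suc m)) (Level-det (suc m) (λ _ → 1) A Level-A)

  monic-d : coeff d (suc m) ≡ 1ℤ
  monic-d = trans (coeff-det-top (suc m) A degree-A)
                  (trans (ℤDet.det-cong (suc m) (λ i j → at (A-entry i j) 1)) (ℤDet.det-identity (suc m)))

  cofactor-sym : ∀ c k → cofactor A c k ≈ₚ cofactor A k c
  cofactor-sym c k = *ₚ-cancelʳ-monic (suc m) d (degree-det (suc m) A degree-A) monic-d
                       (cofactor-sym-*det (suc m) A A-sym k c)

  T : Poly
  T = ∑< (suc m) (cofactor A)

  Level-T+T : Level (suc m) (T +ₚ T)
  Level-T+T = Level-+ₚ-self (Level-∑< (suc m) (cofactor A) (λ c k → Level-det-[]≔ m A c (δ k) Level-A))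

  -- det(A − J) = det A − 𝟙ᵀ adj(A) 𝟙, and 𝟙ᵀ adj(A) 𝟙 = tr adj(A) + 2T = (det A)′ + 2T.
  charPoly≈ : charPoly (suc m) H ≈ₚ d +ₚ (-ₚ (∂ d +ₚ (T +ₚ T)))
  charPoly≈ = begin
    det (suc m) (xI-H H)
      ≈⟨ det-cong (suc m) (λ i j → ≈ₚ-sym (add-sub (xI-H H i j))) ⟩
    det (suc m) (λ i j → A i j +ₚ (-ₚ 1ₚ))
      ≈⟨ det-subtractRow (suc m) A (λ _ → 1ₚ) ⟩
    d +ₚ (-ₚ (∑[ c < suc m ] det (suc m) (A [ c ]≔ (λ _ → 1ₚ))))
      ≈⟨ +ₚ-congˡ d (scaleₚ-cong (- 1ℤ) (∑-cong (suc m) rowSum)) ⟩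
    d +ₚ (-ₚ (∑[ c < suc m ] ∑[ k < suc m ] cofactor A c k))
      ≈⟨ +ₚ-congˡ d (scaleₚ-cong (- 1ℤ) (∑∑-sym (suc m) (cofactor A) cofactor-sym)) ⟩
    d +ₚ (-ₚ ((∑[ c < suc m ] cofactor A c c) +ₚ (T +ₚ T)))
      ≈⟨ +ₚ-congˡ d (scaleₚ-cong (- 1ℤ) (+ₚ-congʳ (T +ₚ T) trace)) ⟩
    d +ₚ (-ₚ (∂ d +ₚ (T +ₚ T)))
      ∎
    where
    open ≈ₚ-Reasoning
    add-sub : ∀ p → (p +ₚ 1ₚ) +ₚ (-ₚ 1ₚ) ≈ₚ p
    add-sub p = ≈ₚ-trans (+ₚ-assoc p 1ₚ (-ₚ 1ₚ))
                         (≈ₚ-trans (+ₚ-congˡ p (+ₚ-inverseʳ 1ₚ)) (+ₚ-identityʳ p))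
    rowSum : ∀ c → det (suc m) (A [ c ]≔ (λ _ → 1ₚ)) ≈ₚ ∑[ k < suc m ] cofactor A c k
    rowSum c = ≈ₚ-trans (det-expandRow (suc m) A c (λ _ → 1ₚ))
                        (∑-cong (suc m) (λ k → *ₚ-identityˡ (cofactor A c k)))
    trace : ∑[ c < suc m ] cofactor A c c ≈ₚ ∂ d
    trace = ≈ₚ-sym (≈ₚ-trans (∂-det (suc m) A) (∑-cong (suc m) (λ r → det-[]≔-cong (suc m) A r (∂-A r))))

  charPoly-coeff-∣ : ∀ j → j < suc m → + 2 ∣ + suc j → 2^ (suc m ∸ j) ∣ coeff (charPoly (suc m) H) j
  charPoly-coeff-∣ j j<n 2∣1+j = subst (2^ (suc m ∸ j) ∣_) (sym coeff-charPoly)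
    (∣m∣n⇒∣m+n (divides-coeff Level-d j)
               (∣m⇒∣-m (∣m∣n⇒∣m+n (Level-∂ j j<n 2∣1+j Level-d) (divides-coeff Level-T+T j))))
    where
    coeff-charPoly : coeff (charPoly (suc m) H) j ≡ coeff d j +ℤ - (coeff (∂ d) j +ℤ coeff (T +ₚ T) j)
    coeff-charPoly = trans (at charPoly≈ j) (trans (coeff-+ₚ d _ j) (cong (coeff d j +ℤ_)
                       (trans (coeff--ₚ (∂ d +ₚ (T +ₚ T)) j) (cong -_ (coeff-+ₚ (∂ d) (T +ₚ T) j)))))

open import Data.Nat using (_+_; _*_; _^_; _≤_; _%_; _∸_)
open import Data.Nat.Properties using (m∸n+n≡m; m∸[m∸n]≡n; ∸-monoʳ-<)
open import Data.Nat.DivMod using ([m+kn]%n≡m%n; %-distribˡ-+)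
open import Data.Nat.Divisibility using (m%n≡0⇒n∣m)
open import Data.Nat.Tactic.RingSolver using (solve-∀)
open import Data.Integer.Divisibility using (_∣_)
open import Data.Integer.Divisibility.Signed using (∣⇒∣ᵤ; ∣ᵤ⇒∣) renaming (_∣_ to _∣ˢ_)
open TwoAdicLevel using (2^_)

suc[n∸k]-even : ∀ n k → k ≤ n → (n + k) % 2 ≡ 1 → + 2 ∣ˢ + suc (n ∸ k)
suc[n∸k]-even n k k≤n odd = ∣ᵤ⇒∣ (m%n≡0⇒n∣m (suc (n ∸ k)) 2 (begin
  suc (n ∸ k) % 2            ≡⟨ [m+kn]%n≡m%n (suc (n ∸ k)) k 2 ⟨
  (suc (n ∸ k) + k * 2) % 2  ≡⟨ ≡.cong (λ x → suc x % 2) (≡.trans (regroup (n ∸ k) k)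
                                                                 (≡.cong (_+ k) (m∸n+n≡m k≤n))) ⟩
  suc (n + k) % 2            ≡⟨ %-distribˡ-+ 1 (n + k) 2 ⟩
  (1 + (n + k) % 2) % 2      ≡⟨ ≡.cong (λ r → (1 + r) % 2) odd ⟩
  0                          ∎))
  where
  open ≡.≡-Reasoning
  regroup : ∀ a k → a + k * 2 ≡ a + k + k
  regroup = solve-∀

lemma2p4 : (n k : ℕ) → 1 ≤ k → k ≤ n → (H : Matrix ℤ n)
         → (∀ i j → H i j ≡ H j i)
         → (∀ i j → H i j ≡ 1ℤ ⊎ H i j ≡ - 1ℤ)
         → (n + k) % 2 ≡ 1
         → (+ (2 ^ k)) ∣ charCoeff n H k
lemma2p4 zero    zero    ()
lemma2p4 zero    (suc k) _   ()
lemma2p4 (suc m) k       1≤k k≤n H H-sym H-±1 odd =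
  ∣⇒∣ᵤ (≡.subst (λ e → 2^ e ∣ˢ charCoeff (suc m) H k) (m∸[m∸n]≡n k≤n)
         (SignMatrix.charPoly-coeff-∣ m H H-sym H-±1 (suc m ∸ k) (∸-monoʳ-< 1≤k k≤n)
                                      (suc[n∸k]-even (suc m) k k≤n odd)))
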